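{- In $\mathsf{CNOT}$, for every map $f:n\to m$, the endomorphism $ff^\circ:n\to n$ is latchable, i.e. $ff^\circ=\Delta_n(ff^\circ\otimes1_n)\nabla_n$.
   Context: $\mathsf{CNOT}$ is the strict symmetric monoidal category with objects the natural numbers ($n\otimes m=n+m$) generated by $\mathsf{cnot}:2\to2$, $|1\rangle:0\to1$, $\langle1|:1\to0$ (and symmetry $\sigma$) modulo exactly the following identities (diagrammatic composition, $fg$ = first $f$ then $g$; $C_{i\to j}$ the cnot with control wire $i$, target wire $j$; $\mathsf{cnot}=C_{1\to2}$): $C_{1\to2}C_{2\to1}C_{1\to2}=\sigma$; $C_{1\to2}C_{1\to2}=1_2$; $C_{2\to1}C_{2\to3}=C_{2\to3}C_{2\to1}$; $(|1\rangle\otimes1)C_{1\to2}=(|1\rangle\otimes1)C_{1\to2}(\langle1|\otimes1)(|1\rangle\otimes1)$ and $C_{1\to2}(\langle1|\otimes1)=(\langle1|\otimes1)(|1\rangle\otimes1)C_{1\to2}(\langle1|\otimes1)$; $C_{1\to2}C_{3\to2}=C_{3\to2}C_{1\to2}$; $|1\rangle\langle1|=1_0$; $(|1\rangle\otimes|1\rangle\otimes1)C_{1\to2}C_{2\to3}(\langle1|\otimes1_2)=(|1\rangle\otimes|1\rangle\otimes1)C_{1\to2}(\langle1|\otimes1_2)$ and $(|1\rangle\otimes1_2)C_{2\to3}C_{1\to2}(\langle1|\otimes\langle1|\otimes1)=(|1\rangle\otimes1_2)C_{1\to2}(\langle1|\otimes\langle1|\otimes1)$; $C_{1\to2}C_{2\to3}C_{1\to2}=C_{2\to3}C_{1\to3}$;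 $(|1\rangle\otimes|1\rangle\otimes1)C_{1\to2}(\langle1|\otimes\langle1|\otimes1)=(|1\rangle\otimes|1\rangle\otimes\langle1|)C_{1\to2}(\langle1|\otimes\langle1|\otimes|1\rangle)$. The horizontal flip $(-)^\circ:\mathsf{CNOT}^{op}\to\mathsf{CNOT}$ is the identity-on-objects monoidal functor fixing $\mathsf{cnot},\sigma$ and exchanging $|1\rangle,\langle1|$. $|0\rangle:=(|1\rangle\otimes|1\rangle)C_{1\to2}(\langle1|\otimes1_1)$; $\Delta_0:=1_0$, $\Delta_1:=(|0\rangle\otimes1_1)C_{2\to1}$, $\Delta_n:=(\Delta_{n-1}\otimes\Delta_1)(1_{n-1}\otimes s\otimes1_1)$ for $n>1$ with $s:(n-1)+1\to1+(n-1)$ the symmetry; $\nabla_n:=\Delta_n^\circ$. A map $g:n\to n$ is latchable if $g=\Delta_n(g\otimes1_n)\nabla_n$. -}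

module Defs where

open import Data.Nat using (ℕ; zero; suc; _+_)
open import Data.Nat.Properties using (+-assoc; +-identityʳ; +-suc; +-comm)
open import Relation.Binary.PropositionalEquality using (_≡_; refl; sym; trans; cong)

infixl 5 _⨾_
infixr 6 _⊗_

-- Syntax of morphisms of the free strict symmetric monoidal category on the
-- generators cnot : 2 → 2, |1⟩ : 0 → 1, ⟨1| : 1 → 0.
-- Composition is diagrammatic: f ⨾ g = first f, then g.
data Tm : ℕ → ℕ → Set where
  id   : (a : ℕ) → Tm a a
  _⨾_  : {a b c : ℕ} → Tm a b → Tm b c → Tm a c
  _⊗_  : {a b c d : ℕ} → Tm a b → Tm c d → Tm (a + c) (b + d)
  σ    : (a b : ℕ) → Tm (a + b) (b + a)
  cnot : Tm 2 2
  ket1 : Tm 0 1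
  bra1 : Tm 1 0

-- transport along equalities of objects (needed for strict associativity/unit)
cast : {a a' b b' : ℕ} → a ≡ a' → b ≡ b' → Tm a b → Tm a' b'
cast refl refl f = f

C12 : Tm 2 2
C12 = cnot

C21 : Tm 2 2
C21 = σ 1 1 ⨾ cnot ⨾ σ 1 1

C12₃ : Tm 3 3
C12₃ = cnot ⊗ id 1

C21₃ : Tm 3 3
C21₃ = C21 ⊗ id 1

C23₃ : Tm 3 3
C23₃ = id 1 ⊗ cnot

C32₃ : Tm 3 3
C32₃ = id 1 ⊗ C21

C13₃ : Tm 3 3
C13₃ = (id 1 ⊗ σ 1 1) ⨾ (cnot ⊗ id 1) ⨾ (id 1 ⊗ σ 1 1)

infix 4 _≈_

data _≈_ : {a b : ℕ} → Tm a b → Tm a b → Set where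
  ≈-refl  : {a b : ℕ} {f : Tm a b} → f ≈ f
  ≈-sym   : {a b : ℕ} {f g : Tm a b} → f ≈ g → g ≈ f
  ≈-trans : {a b : ℕ} {f g h : Tm a b} → f ≈ g → g ≈ h → f ≈ h
  ⨾-cong  : {a b c : ℕ} {f f' : Tm a b} {g g' : Tm b c} → f ≈ f' → g ≈ g' → f ⨾ g ≈ f' ⨾ g'
  ⊗-cong  : {a b c d : ℕ} {f f' : Tm a b} {g g' : Tm c d} → f ≈ f' → g ≈ g' → f ⊗ g ≈ f' ⊗ g'
  idˡ     : {a b : ℕ} {f : Tm a b} → id a ⨾ f ≈ f
  idʳ     : {a b : ℕ} {f : Tm a b} → f ⨾ id b ≈ f
  ⨾-assoc : {a b c d : ℕ} {f : Tm a b} {g : Tm b c} {h : Tm c d} → (f ⨾ g) ⨾ h ≈ f ⨾ (g ⨾ h)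
  ⊗-id    : {a c : ℕ} → id a ⊗ id c ≈ id (a + c)
  interchange : {a b c d e k : ℕ} {f : Tm a b} {g : Tm b c} {h : Tm d e} {l : Tm e k} →
            (f ⨾ g) ⊗ (h ⨾ l) ≈ (f ⊗ h) ⨾ (g ⊗ l)
  ⊗-unitˡ : {a b : ℕ} {f : Tm a b} → id 0 ⊗ f ≈ f
  ⊗-unitʳ : {a b : ℕ} {f : Tm a b} → cast (+-identityʳ a) (+-identityʳ b) (f ⊗ id 0) ≈ f
  ⊗-assoc : {a b c d e k : ℕ} {f : Tm a b} {g : Tm c d} {h : Tm e k} →
            cast (+-assoc a c e) (+-assoc b d k) ((f ⊗ g) ⊗ h) ≈ f ⊗ (g ⊗ h)
  σ-inv   : {a b : ℕ} → σ a b ⨾ σ b a ≈ id (a + b)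
  σ-nat   : {a b c d : ℕ} {f : Tm a b} {g : Tm c d} → (f ⊗ g) ⨾ σ b d ≈ σ a c ⨾ (g ⊗ f)
  σ-hex   : {a b c : ℕ} →
            σ a (b + c) ≈ cast (+-assoc a b c) (sym (+-assoc b c a))
                            ((σ a b ⊗ id c) ⨾ cast (sym (+-assoc b a c)) refl (id b ⊗ σ a c))
  σ-unit  : {a : ℕ} → σ a 0 ≈ cast (sym (+-identityʳ a)) refl (id a)
  r1  : C12 ⨾ C21 ⨾ C12 ≈ σ 1 1
  r2  : C12 ⨾ C12 ≈ id 2
  r3  : C21₃ ⨾ C23₃ ≈ C23₃ ⨾ C21₃
  r4a : (ket1 ⊗ id 1) ⨾ C12 ≈ (ket1 ⊗ id 1) ⨾ C12 ⨾ (bra1 ⊗ id 1) ⨾ (ket1 ⊗ id 1)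
  r4b : C12 ⨾ (bra1 ⊗ id 1) ≈ (bra1 ⊗ id 1) ⨾ (ket1 ⊗ id 1) ⨾ C12 ⨾ (bra1 ⊗ id 1)
  r5  : C12₃ ⨾ C32₃ ≈ C32₃ ⨾ C12₃
  r6  : ket1 ⨾ bra1 ≈ id 0
  r7a : (ket1 ⊗ ket1 ⊗ id 1) ⨾ C12₃ ⨾ C23₃ ⨾ (bra1 ⊗ id 2)
        ≈ (ket1 ⊗ ket1 ⊗ id 1) ⨾ C12₃ ⨾ (bra1 ⊗ id 2)
  r7b : (ket1 ⊗ id 2) ⨾ C23₃ ⨾ C12₃ ⨾ (bra1 ⊗ bra1 ⊗ id 1)
        ≈ (ket1 ⊗ id 2) ⨾ C12₃ ⨾ (bra1 ⊗ bra1 ⊗ id 1)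
  r8  : C12₃ ⨾ C23₃ ⨾ C12₃ ≈ C23₃ ⨾ C13₃
  r9  : (ket1 ⊗ ket1 ⊗ id 1) ⨾ C12₃ ⨾ (bra1 ⊗ bra1 ⊗ id 1)
        ≈ (ket1 ⊗ ket1 ⊗ bra1) ⨾ C12 ⨾ (bra1 ⊗ bra1 ⊗ ket1)

flip : {a b : ℕ} → Tm a b → Tm b a
flip (id a)  = id a
flip (f ⨾ g) = flip g ⨾ flip f
flip (f ⊗ g) = flip f ⊗ flip g
flip (σ a b) = σ b a
flip cnot    = cnot
flip ket1    = bra1
flip bra1    = ket1

ket0 : Tm 0 1
ket0 = (ket1 ⊗ ket1) ⨾ cnot ⨾ (bra1 ⊗ id 1)

Δ₁ : Tm 1 2
Δ₁ = (ket0 ⊗ id 1) ⨾ C21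

private
  e-dom : (m : ℕ) → m + 1 ≡ suc m
  e-dom m = trans (+-suc m 0) (cong suc (+-identityʳ m))

  e-mid : (m : ℕ) → m + ((m + 1) + 1) ≡ (m + m) + (1 + 1)
  e-mid m = trans (cong (m +_) (+-assoc m 1 1)) (sym (+-assoc m m (1 + 1)))

  e-cod : (m : ℕ) → m + ((1 + m) + 1) ≡ suc m + suc m
  e-cod m = trans (cong (m +_) (cong suc (e-dom m))) (trans (+-suc m (suc m)) refl)

Δ : (n : ℕ) → Tm n (n + n)
Δ zero = id 0
Δ (suc zero) = Δ₁
Δ (suc (suc k)) =
  cast (e-dom (suc k)) (e-cod (suc k))
    ((Δ (suc k) ⊗ Δ₁) ⨾ cast (e-mid (suc k)) refl (id (suc k) ⊗ (σ (suc k) 1 ⊗ id 1)))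

∇ : (n : ℕ) → Tm (n + n) n
∇ n = flip (Δ n)

Latchable : {n : ℕ} → Tm n n → Set
Latchable {n} g = g ≈ Δ n ⨾ (g ⊗ id n) ⨾ ∇ n

-- Every map f of CNOT is "copyable": the copy map Δ is natural for f,
-- f ⨾ Δ ≈ Δ ⨾ (f ⊗ f), and f acting on one copy equals f followed by its flip f° on the
-- other copy, Δ ⨾ (f ⊗ 1) ≈ f ⨾ Δ ⨾ (1 ⊗ f°). Both properties are closed under ⨾ and ⊗
-- (for ⊗ because Δ (a + c) is Δ a ⊗ Δ c followed by an interleaving of wires), so it
-- suffices to check the generators; for cnot this rests on |0⟩ being an invisible control
-- (relation r7a) and on the commutation relations r3, r8. Flipping naturality gives
-- ∇ ⨾ f° ≈ (f° ⊗ f°) ⨾ ∇, and Δ ⨾ ∇ ≈ 1 because |0⟩ ⨾ ⟨0| ≈ 1. Hence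
--   Δ ⨾ (f ⨾ f° ⊗ 1) ⨾ ∇ ≈ f ⨾ Δ ⨾ (1 ⊗ f°) ⨾ (f° ⊗ 1) ⨾ ∇ ≈ f ⨾ Δ ⨾ ∇ ⨾ f° ≈ f ⨾ f°.
module Submission where

open import Defs
open import Data.Nat using (ℕ; zero; suc; _+_)
open import Data.Nat.Properties using (+-assoc; +-identityʳ; +-suc; +-comm; ≡-irrelevant)
open import Data.Nat.Tactic.RingSolver using (solve-∀; solve)
open import Data.List using (_∷_; [])
open import Relation.Binary.PropositionalEquality using (_≡_; refl; sym; trans; cong; cong₂)
open import Data.Product using (_×_; _,_)

module ≈-Reasoning where
  infix  1 begin_
  infixr 2 _≈⟨_⟩_
  infix  3 _∎

  begin_ : ∀ {a b} {f g : Tm a b} → f ≈ g → f ≈ g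
  begin e = e

  _≈⟨_⟩_ : ∀ {a b} (f : Tm a b) {g h : Tm a b} → f ≈ g → g ≈ h → f ≈ h
  f ≈⟨ e ⟩ e' = ≈-trans e e'

  _∎ : ∀ {a b} (f : Tm a b) → f ≈ f
  f ∎ = ≈-refl

open ≈-Reasoning

≡⇒≈ : ∀ {a b} {f g : Tm a b} → f ≡ g → f ≈ g
≡⇒≈ refl = ≈-refl

≈-left : ∀ {a b c} {f f' : Tm a b} {g : Tm b c} → f ≈ f' → f ⨾ g ≈ f' ⨾ g
≈-left e = ⨾-cong e ≈-refl

≈-right : ∀ {a b c} {f : Tm a b} {g g' : Tm b c} → g ≈ g' → f ⨾ g ≈ f ⨾ g'
≈-right e = ⨾-cong ≈-refl e

≈-middle : ∀ {a b c d} {f : Tm a b} {g g' : Tm b c} {h : Tm c d} → g ≈ g' → (f ⨾ g) ⨾ h ≈ (f ⨾ g') ⨾ h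
≈-middle e = ≈-left (≈-right e)

-- Terms whose objects agree only up to a proof of equality in ℕ (strict associativity and
-- unit hold in ℕ only propositionally) are compared by transporting the first one.
infix 4 _≅_
record _≅_ {a b a' b' : ℕ} (f : Tm a b) (g : Tm a' b') : Set where
  constructor mk≅
  field
    pa : a ≡ a'
    pb : b ≡ b'
    eq : cast pa pb f ≈ g

cast-irrelevant : ∀ {a a' b b'} (p p' : a ≡ a') (q q' : b ≡ b') (f : Tm a b) → cast p q f ≡ cast p' q' f
cast-irrelevant p p' q q' f rewrite ≡-irrelevant p p' | ≡-irrelevant q q' = refl

cast-cong : ∀ {a b a' b'} {p : a ≡ a'} {q : b ≡ b'} {f g : Tm a b} → f ≈ g → cast p q f ≈ cast p q g
cast-cong {p = refl} {refl} e = e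

≈⇒≅ : ∀ {a b} {f g : Tm a b} → f ≈ g → f ≅ g
≈⇒≅ e = mk≅ refl refl e

≅⇒≈ : ∀ {a b} {f g : Tm a b} → f ≅ g → f ≈ g
≅⇒≈ {f = f} (mk≅ p q e) = ≈-trans (≡⇒≈ (cast-irrelevant refl p refl q f)) e

≅-refl : ∀ {a b} {f : Tm a b} → f ≅ f
≅-refl = mk≅ refl refl ≈-refl

≅-sym : ∀ {a b a' b'} {f : Tm a b} {g : Tm a' b'} → f ≅ g → g ≅ f
≅-sym (mk≅ refl refl e) = mk≅ refl refl (≈-sym e)

≅-trans : ∀ {a b a' b' a'' b''} {f : Tm a b} {g : Tm a' b'} {h : Tm a'' b''} → f ≅ g → g ≅ h → f ≅ h
≅-trans (mk≅ refl refl e) (mk≅ p q e') = mk≅ p q (≈-trans (cast-cong e) e')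

≡⇒≅ : ∀ {a b} {f g : Tm a b} → f ≡ g → f ≅ g
≡⇒≅ refl = ≅-refl

cast≅ : ∀ {a a' b b'} (p : a ≡ a') (q : b ≡ b') (f : Tm a b) → cast p q f ≅ f
cast≅ refl refl f = ≅-refl

≅cast : ∀ {a a' b b'} (p : a ≡ a') (q : b ≡ b') (f : Tm a b) → f ≅ cast p q f
≅cast p q f = ≅-sym (cast≅ p q f)

castˡ : ∀ {a a' b b' c d} {p : a ≡ a'} {q : b ≡ b'} {f : Tm a b} {g : Tm c d} → f ≅ g → cast p q f ≅ g
castˡ {p = p} {q} {f} e = ≅-trans (cast≅ p q f) e

castʳ : ∀ {a a' b b' c d} {p : a ≡ a'} {q : b ≡ b'} {f : Tm a b} {g : Tm c d} → g ≅ f → g ≅ cast p q f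
castʳ {p = p} {q} {f} e = ≅-trans e (≅cast p q f)

⨾≅ : ∀ {a b c a' b' c'} {f : Tm a b} {g : Tm b c} {f' : Tm a' b'} {g' : Tm b' c'} →
     f ≅ f' → g ≅ g' → (f ⨾ g) ≅ (f' ⨾ g')
⨾≅ {g = g} (mk≅ refl refl e1) (mk≅ q refl e2) =
  mk≅ refl refl (⨾-cong e1 (≈-trans (≡⇒≈ (cast-irrelevant refl q refl refl g)) e2))

⊗≅ : ∀ {a b c d a' b' c' d'} {f : Tm a b} {g : Tm c d} {f' : Tm a' b'} {g' : Tm c' d'} →
     f ≅ f' → g ≅ g' → (f ⊗ g) ≅ (f' ⊗ g')
⊗≅ (mk≅ refl refl e1) (mk≅ refl refl e2) = mk≅ refl refl (⊗-cong e1 e2)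

id≅ : ∀ {a a'} → a ≡ a' → id a ≅ id a'
id≅ refl = ≅-refl

σ≅ : ∀ {a a' b b'} → a ≡ a' → b ≡ b' → σ a b ≅ σ a' b'
σ≅ refl refl = ≅-refl

Δ≅ : ∀ {a a'} → a ≡ a' → Δ a ≅ Δ a'
Δ≅ refl = ≅-refl

infixl 5 _⨾[_]_
_⨾[_]_ : ∀ {a b b' c} → Tm a b → b ≡ b' → Tm b' c → Tm a c
f ⨾[ p ] g = f ⨾ cast (sym p) refl g

⨾[]≅ : ∀ {a b b' c a₁ b₁ b₁' c₁} {f : Tm a b} {g : Tm b' c} {f' : Tm a₁ b₁} {g' : Tm b₁' c₁}
       (p : b ≡ b') (p' : b₁ ≡ b₁') → f ≅ f' → g ≅ g' → (f ⨾[ p ] g) ≅ (f' ⨾[ p' ] g')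
⨾[]≅ {g = g} {g' = g'} p p' e1 e2 =
  ⨾≅ e1 (≅-trans (cast≅ (sym p) refl g) (≅-trans e2 (≅cast (sym p') refl g')))

⨾[]-elim : ∀ {a b b' c a₁ b₁ c₁} {f : Tm a b} {g : Tm b' c} {f' : Tm a₁ b₁} {g' : Tm b₁ c₁}
           (p : b ≡ b') → f ≅ f' → g ≅ g' → (f ⨾[ p ] g) ≅ (f' ⨾ g')
⨾[]-elim {g = g} p e1 e2 = ⨾≅ e1 (≅-trans (cast≅ (sym p) refl g) e2)

⨾[]-irrelevant : ∀ {a b b' c} {f : Tm a b} {g : Tm b' c} (p p' : b ≡ b') → f ⨾[ p ] g ≅ f ⨾[ p' ] g
⨾[]-irrelevant p p' = ⨾[]≅ p p' ≅-refl ≅-refl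

⨾[]-assoc : ∀ {a b b' c c' d} {f : Tm a b} {g : Tm b' c} {h : Tm c' d} (p : b ≡ b') (q : c ≡ c') →
            (f ⨾[ p ] g) ⨾[ q ] h ≅ f ⨾[ p ] (g ⨾[ q ] h)
⨾[]-assoc refl refl = ≈⇒≅ ⨾-assoc

⨾[]-assoc⁻ : ∀ {a b b' c c' d} {f : Tm a b} {g : Tm b' c} {h : Tm c' d} (p : b ≡ b') (q : c ≡ c') →
             f ⨾[ p ] (g ⨾[ q ] h) ≅ (f ⨾[ p ] g) ⨾[ q ] h
⨾[]-assoc⁻ p q = ≅-sym (⨾[]-assoc p q)

idˡ≅ : ∀ {a b} {f : Tm a b} → id a ⨾ f ≅ f
idˡ≅ = ≈⇒≅ idˡ

idʳ≅ : ∀ {a b} {f : Tm a b} → f ⨾ id b ≅ f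
idʳ≅ = ≈⇒≅ idʳ

idˡ-upto : ∀ {a a' b c} {f : Tm a b} {g : Tm b c} → f ≅ id a' → f ⨾ g ≅ g
idˡ-upto e = ≅-trans (⨾≅ (≅-trans e (id≅ (sym (_≅_.pb e)))) ≅-refl) idˡ≅

idˡ[] : ∀ {a a' b' b c} {f : Tm a b} {g : Tm b' c} (p : b ≡ b') → f ≅ id a' → f ⨾[ p ] g ≅ g
idˡ[] p e = ≅-trans (⨾[]-elim p (≅-trans e (id≅ (trans (sym (_≅_.pb e)) p))) ≅-refl) idˡ≅

idʳ-upto : ∀ {a b b' c} {f : Tm a b} {g : Tm b c} → g ≅ id b' → f ⨾ g ≅ f
idʳ-upto e = ≅-trans (⨾≅ ≅-refl (≅-trans e (id≅ (sym (_≅_.pa e))))) idʳ≅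

left-inverse-unique : ∀ {a b a' b' c d} {X : Tm a b} {Y : Tm b a} {R : Tm a' b'} (p : b ≡ a') →
                      (X ⨾[ p ] R) ≅ id c → (Y ⨾ X) ≅ id d → Y ≅ R
left-inverse-unique p XR≅id YX≅id =
  ≅-trans (≅-sym idʳ≅)
  (≅-trans (⨾≅ ≅-refl (≅-sym (≅-trans XR≅id (id≅ (sym (_≅_.pa XR≅id))))))
  (≅-trans (≅-sym (≈⇒≅ ⨾-assoc))
  (≅-trans (⨾≅ (≅-trans YX≅id (id≅ (sym (_≅_.pa YX≅id)))) ≅-refl)
  (≅-trans idˡ≅ (cast≅ _ _ _)))))

-- Symmetric monoidal structure

⨾-assoc≅ : ∀ {a b c d} {f : Tm a b} {g : Tm b c} {h : Tm c d} → (f ⨾ g) ⨾ h ≅ f ⨾ (g ⨾ h)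
⨾-assoc≅ = ≈⇒≅ ⨾-assoc

⊗-assoc≅ : ∀ {a b c d e k} {f : Tm a b} {g : Tm c d} {h : Tm e k} → (f ⊗ g) ⊗ h ≅ f ⊗ (g ⊗ h)
⊗-assoc≅ = mk≅ _ _ ⊗-assoc

⊗-unitʳ≅ : ∀ {a b} {f : Tm a b} → f ⊗ id 0 ≅ f
⊗-unitʳ≅ = mk≅ _ _ ⊗-unitʳ

⊗-unitˡ≅ : ∀ {a b} {f : Tm a b} → id 0 ⊗ f ≅ f
⊗-unitˡ≅ = ≈⇒≅ ⊗-unitˡ

⊗-id≅ : ∀ {a c} → id a ⊗ id c ≅ id (a + c)
⊗-id≅ = ≈⇒≅ ⊗-id

⊗-slide : ∀ {a b c d} {f : Tm a b} {g : Tm c d} → (f ⊗ id c) ⨾ (id b ⊗ g) ≈ (id a ⊗ g) ⨾ (f ⊗ id d)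
⊗-slide = ≈-trans (≈-sym interchange) (≈-trans (⊗-cong (≈-trans idʳ (≈-sym idˡ)) (≈-trans idˡ (≈-sym idʳ))) interchange)

⊗-merge : ∀ {a b c d} {f : Tm a b} {g : Tm c d} → (f ⊗ id c) ⨾ (id b ⊗ g) ≈ f ⊗ g
⊗-merge = ≈-trans (≈-sym interchange) (⊗-cong idʳ idˡ)

⊗-merge′ : ∀ {a b c d} {f : Tm a b} {g : Tm c d} → (id a ⊗ g) ⨾ (f ⊗ id d) ≈ f ⊗ g
⊗-merge′ = ≈-trans (≈-sym interchange) (⊗-cong idˡ idʳ)

id⊗-⨾ : ∀ {a b c k} {g : Tm a b} {h : Tm b c} → id k ⊗ (g ⨾ h) ≈ (id k ⊗ g) ⨾ (id k ⊗ h)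
id⊗-⨾ = ≈-trans (⊗-cong (≈-sym idˡ) ≈-refl) interchange

⨾-⊗id : ∀ {a b c k} {g : Tm a b} {h : Tm b c} → (g ⨾ h) ⊗ id k ≈ (g ⊗ id k) ⨾ (h ⊗ id k)
⨾-⊗id = ≈-trans (⊗-cong ≈-refl (≈-sym idˡ)) interchange

⨾[]-interchange : ∀ {a b b' c d e e' k} {f : Tm a b} {g : Tm b' c} {h : Tm d e} {l : Tm e' k}
                  (p : b ≡ b') (q : e ≡ e') →
                  (f ⨾[ p ] g) ⊗ (h ⨾[ q ] l) ≅ (f ⊗ h) ⨾[ cong₂ _+_ p q ] (g ⊗ l)
⨾[]-interchange refl refl = ≈⇒≅ interchange

id⊗-⨾[] : ∀ {a b b' c k} {g : Tm a b} {h : Tm b' c} (p : b ≡ b') →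
          id k ⊗ (g ⨾[ p ] h) ≅ (id k ⊗ g) ⨾[ cong (k +_) p ] (id k ⊗ h)
id⊗-⨾[] refl = ≈⇒≅ id⊗-⨾

⨾[]-⊗id : ∀ {a b b' c k} {g : Tm a b} {h : Tm b' c} (p : b ≡ b') →
          (g ⨾[ p ] h) ⊗ id k ≅ (g ⊗ id k) ⨾[ cong (_+ k) p ] (h ⊗ id k)
⨾[]-⊗id refl = ≈⇒≅ ⨾-⊗id

⨾[]-⊗ : ∀ {a b b' c' c d} {f : Tm a b} {g : Tm b' c'} {h : Tm c d} (p : b ≡ b') →
        (f ⨾[ p ] g) ⊗ h ≅ (f ⊗ h) ⨾[ cong (_+ d) p ] (g ⊗ id d)
⨾[]-⊗ refl = ≈⇒≅ (≈-trans (⊗-cong ≈-refl (≈-sym idʳ)) interchange)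

⊗-⨾[] : ∀ {a b b' c' c d} {f : Tm a b} {g : Tm b' c'} {h : Tm c d} (p : b ≡ b') →
        h ⊗ (f ⨾[ p ] g) ≅ (h ⊗ f) ⨾[ cong (d +_) p ] (id d ⊗ g)
⊗-⨾[] refl = ≈⇒≅ (≈-trans (⊗-cong (≈-sym idʳ) ≈-refl) interchange)

σ-unitʳ≅ : ∀ {a} → σ a 0 ≅ id a
σ-unitʳ≅ = ≅-trans (≈⇒≅ σ-unit) (cast≅ _ _ _)

σ-unitˡ≅ : ∀ {a} → σ 0 a ≅ id a
σ-unitˡ≅ {a} = ≅-trans (≅-sym idˡ≅) (≅-trans (⨾≅ (≅-sym (σ-unitʳ≅ {a})) (≅-refl {f = σ 0 a}))
                 (≅-trans (≈⇒≅ σ-inv) (id≅ (+-identityʳ a))))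

σ₀₁ : σ 0 1 ≈ id 1
σ₀₁ = ≅⇒≈ σ-unitˡ≅

σ-hexagon : ∀ {a b c} → σ a (b + c) ≅ (σ a b ⊗ id c) ⨾[ +-assoc b a c ] (id b ⊗ σ a c)
σ-hexagon = ≅-trans (≈⇒≅ σ-hex) (cast≅ _ _ _)

-- The other hexagon is the inverse of the given one.
σ-hexagon′ : ∀ {a b c} → σ (b + c) a ≅ (id b ⊗ σ c a) ⨾[ sym (+-assoc b a c) ] (σ b a ⊗ id c)
σ-hexagon′ {a} {b} {c} = left-inverse-unique (+-assoc b c a) hexagons-cancel (≈⇒≅ σ-inv)
  where
  hexagons-cancel : σ a (b + c) ⨾[ +-assoc b c a ]
                      ((id b ⊗ σ c a) ⨾[ sym (+-assoc b a c) ] (σ b a ⊗ id c)) ≅ id ((a + b) + c)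
  hexagons-cancel =
    ≅-trans (⨾[]≅ (+-assoc b c a) refl σ-hexagon ≅-refl)
    (≅-trans (⨾[]-assoc (+-assoc b a c) refl)
    (≅-trans (⨾[]≅ (+-assoc b a c) refl ≅-refl
               (≅-trans (≅-sym (⨾[]-assoc refl (sym (+-assoc b a c))))
                (idˡ[] (sym (+-assoc b a c))
                  (≅-trans (≈⇒≅ (≈-sym interchange))
                   (≅-trans (⊗≅ idˡ≅ (≈⇒≅ σ-inv)) ⊗-id≅)))))
    (≅-trans (≈⇒≅ (≈-sym interchange)) (≅-trans (⊗≅ (≈⇒≅ σ-inv) idˡ≅) ⊗-id≅))))

-- Right-associates every composite and drops left identities, so that two terms differing
-- only in bracketing of ⨾ become syntactically equal.
⨾-append : ∀ {a b c} → Tm a b → Tm b c → Tm a c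
⨾-append (x ⨾ y) z = x ⨾ ⨾-append y z
⨾-append (id a)  z = z
⨾-append (x ⊗ y) z = (x ⊗ y) ⨾ z
⨾-append (σ a b) z = σ a b ⨾ z
⨾-append cnot    z = cnot ⨾ z
⨾-append ket1    z = ket1 ⨾ z
⨾-append bra1    z = bra1 ⨾ z

rebracket : ∀ {a b} → Tm a b → Tm a b
rebracket (f ⨾ g) = ⨾-append (rebracket f) (rebracket g)
rebracket (f ⊗ g) = rebracket f ⊗ rebracket g
rebracket (id a)  = id a
rebracket (σ a b) = σ a b
rebracket cnot    = cnot
rebracket ket1    = ket1
rebracket bra1    = bra1

⨾-append≈ : ∀ {a b c} (x : Tm a b) (z : Tm b c) → ⨾-append x z ≈ x ⨾ z
⨾-append≈ (x ⨾ y) z = ≈-trans (≈-right (⨾-append≈ y z)) (≈-sym ⨾-assoc)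
⨾-append≈ (id a)  z = ≈-sym idˡ
⨾-append≈ (x ⊗ y) z = ≈-refl
⨾-append≈ (σ a b) z = ≈-refl
⨾-append≈ cnot    z = ≈-refl
⨾-append≈ ket1    z = ≈-refl
⨾-append≈ bra1    z = ≈-refl

rebracket≈ : ∀ {a b} (f : Tm a b) → rebracket f ≈ f
rebracket≈ (f ⨾ g) = ≈-trans (⨾-append≈ (rebracket f) (rebracket g)) (⨾-cong (rebracket≈ f) (rebracket≈ g))
rebracket≈ (f ⊗ g) = ⊗-cong (rebracket≈ f) (rebracket≈ g)
rebracket≈ (id a)  = ≈-refl
rebracket≈ (σ a b) = ≈-refl
rebracket≈ cnot    = ≈-refl
rebracket≈ ket1    = ≈-refl
rebracket≈ bra1    = ≈-refl

≈-rebracket : ∀ {a b} {f g : Tm a b} → rebracket f ≡ rebracket g → f ≈ g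
≈-rebracket {f = f} {g} e = ≈-trans (≈-sym (rebracket≈ f)) (≈-trans (≡⇒≈ e) (rebracket≈ g))

≈-rebracket-around : ∀ {a b} {x y x' y' : Tm a b} →
                     rebracket x ≡ rebracket x' → x' ≈ y' → rebracket y' ≡ rebracket y → x ≈ y
≈-rebracket-around e₁ e e₂ = ≈-trans (≈-rebracket e₁) (≈-trans e (≈-rebracket e₂))

⊗id-involutive : ∀ {a k} {x : Tm a a} → x ⨾ x ≈ id a → (x ⊗ id k) ⨾ (x ⊗ id k) ≈ id (a + k)
⊗id-involutive xx = ≈-trans (≈-sym interchange) (≈-trans (⊗-cong xx idˡ) ⊗-id)

id⊗-involutive : ∀ {a k} {x : Tm a a} → x ⨾ x ≈ id a → (id k ⊗ x) ⨾ (id k ⊗ x) ≈ id (k + a)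
id⊗-involutive xx = ≈-trans (≈-sym interchange) (≈-trans (⊗-cong idˡ xx) ⊗-id)

conjugate-⨾ : ∀ {n} {s x y : Tm n n} → s ⨾ s ≈ id n → (s ⨾ x ⨾ s) ⨾ (s ⨾ y ⨾ s) ≈ s ⨾ (x ⨾ y) ⨾ s
conjugate-⨾ {n} {s} {x} {y} ss = begin
  (s ⨾ x ⨾ s) ⨾ (s ⨾ y ⨾ s)   ≈⟨ ≈-sym ⨾-assoc ⟩
  ((s ⨾ x ⨾ s) ⨾ (s ⨾ y)) ⨾ s ≈⟨ ≈-left (≈-sym ⨾-assoc) ⟩
  ((s ⨾ x ⨾ s) ⨾ s ⨾ y) ⨾ s   ≈⟨ ≈-left (≈-left ⨾-assoc) ⟩
  ((s ⨾ x) ⨾ (s ⨾ s) ⨾ y) ⨾ s ≈⟨ ≈-left (≈-middle ss) ⟩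
  ((s ⨾ x) ⨾ id n ⨾ y) ⨾ s    ≈⟨ ≈-left (≈-left idʳ) ⟩
  ((s ⨾ x) ⨾ y) ⨾ s           ≈⟨ ≈-left ⨾-assoc ⟩
  s ⨾ (x ⨾ y) ⨾ s             ∎

conjugate-involutive : ∀ {n} {s x : Tm n n} → s ⨾ s ≈ id n → x ⨾ x ≈ id n →
                       (s ⨾ x ⨾ s) ⨾ (s ⨾ x ⨾ s) ≈ id n
conjugate-involutive {n} {s} {x} ss xx = begin
  (s ⨾ x ⨾ s) ⨾ (s ⨾ x ⨾ s) ≈⟨ conjugate-⨾ ss ⟩
  s ⨾ (x ⨾ x) ⨾ s           ≈⟨ ≈-middle xx ⟩
  s ⨾ id n ⨾ s              ≈⟨ ≈-left idʳ ⟩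
  s ⨾ s                     ≈⟨ ss ⟩
  id n                      ∎

involutions-commute : ∀ {n} {x y : Tm n n} → x ⨾ x ≈ id n → y ⨾ y ≈ id n →
                      (y ⨾ x) ⨾ (y ⨾ x) ≈ id n → x ⨾ y ≈ y ⨾ x
involutions-commute {n} {x} {y} xx yy yxyx = begin
  x ⨾ y                              ≈⟨ ≈-sym idʳ ⟩
  (x ⨾ y) ⨾ id n                     ≈⟨ ≈-right (≈-sym yxyx) ⟩
  (x ⨾ y) ⨾ ((y ⨾ x) ⨾ (y ⨾ x))      ≈⟨ ⨾-assoc ⟩
  x ⨾ (y ⨾ ((y ⨾ x) ⨾ (y ⨾ x)))      ≈⟨ ≈-right (≈-right ⨾-assoc) ⟩
  x ⨾ (y ⨾ (y ⨾ (x ⨾ (y ⨾ x))))      ≈⟨ ≈-right (≈-sym ⨾-assoc) ⟩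
  x ⨾ ((y ⨾ y) ⨾ (x ⨾ (y ⨾ x)))      ≈⟨ ≈-right (≈-trans (≈-left yy) idˡ) ⟩
  x ⨾ (x ⨾ (y ⨾ x))                  ≈⟨ ≈-sym ⨾-assoc ⟩
  (x ⨾ x) ⨾ (y ⨾ x)                  ≈⟨ ≈-trans (≈-left xx) idˡ ⟩
  y ⨾ x                              ∎

C12₃-involutive : C12₃ ⨾ C12₃ ≈ id 3
C12₃-involutive = ⊗id-involutive r2

C23₃-involutive : C23₃ ⨾ C23₃ ≈ id 3
C23₃-involutive = id⊗-involutive r2

C13₃-involutive : C13₃ ⨾ C13₃ ≈ id 3
C13₃-involutive = conjugate-involutive (id⊗-involutive σ-inv) C12₃-involutive

C13₃-C23₃-comm : C13₃ ⨾ C23₃ ≈ C23₃ ⨾ C13₃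
C13₃-C23₃-comm = involutions-commute C13₃-involutive C23₃-involutive
  (≈-trans (⨾-cong (≈-sym r8) (≈-sym r8)) (conjugate-involutive C12₃-involutive C23₃-involutive))

flip-cast : ∀ {a a' b b'} (p : a ≡ a') (q : b ≡ b') (f : Tm a b) → flip (cast p q f) ≡ cast q p (flip f)
flip-cast refl refl f = refl

-- The flip of each defining relation of CNOT is, up to rebracketing, again a relation.
flip-cong : ∀ {a b} {f g : Tm a b} → f ≈ g → flip f ≈ flip g
flip-cong ≈-refl          = ≈-refl
flip-cong (≈-sym e)       = ≈-sym (flip-cong e)
flip-cong (≈-trans e e')  = ≈-trans (flip-cong e) (flip-cong e')
flip-cong (⨾-cong e e')   = ⨾-cong (flip-cong e') (flip-cong e)
flip-cong (⊗-cong e e')   = ⊗-cong (flip-cong e) (flip-cong e')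
flip-cong idˡ             = idʳ
flip-cong idʳ             = idˡ
flip-cong ⨾-assoc         = ≈-sym ⨾-assoc
flip-cong ⊗-id            = ⊗-id
flip-cong interchange     = interchange
flip-cong ⊗-unitˡ         = ⊗-unitˡ
flip-cong (⊗-unitʳ {a} {b} {f}) =
  ≈-trans (≡⇒≈ (flip-cast (+-identityʳ a) (+-identityʳ b) (f ⊗ id 0))) ⊗-unitʳ
flip-cong (⊗-assoc {a} {b} {c} {d} {e} {k} {f} {g} {h}) =
  ≈-trans (≡⇒≈ (flip-cast (+-assoc a c e) (+-assoc b d k) ((f ⊗ g) ⊗ h))) ⊗-assoc
flip-cong σ-inv           = σ-inv
flip-cong σ-nat           = ≈-sym σ-nat
flip-cong (σ-hex {a} {b} {c}) = ≅⇒≈ (≅-trans σ-hexagon′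
  (≅-sym (≅-trans (≡⇒≅ (flip-cast (+-assoc a b c) (sym (+-assoc b c a)) _))
    (castˡ (⨾≅ (≅-trans (≡⇒≅ (flip-cast (sym (+-assoc b a c)) refl (id b ⊗ σ a c))) (cast≅ _ _ _))
               (≅cast _ _ _))))))
flip-cong (σ-unit {a})    = ≅⇒≈ (≅-trans σ-unitˡ≅ (≅-trans (≅cast refl (sym (+-identityʳ a)) (id a))
  (≡⇒≅ (sym (flip-cast (sym (+-identityʳ a)) refl (id a))))))
flip-cong r1  = ≈-rebracket-around refl r1 refl
flip-cong r2  = r2
flip-cong r3  = ≈-rebracket-around refl (≈-sym r3) refl
flip-cong r4a = ≈-rebracket-around refl r4b refl
flip-cong r4b = ≈-rebracket-around refl r4a refl
flip-cong r5  = ≈-rebracket-around refl (≈-sym r5) refl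
flip-cong r6  = r6
flip-cong r7a = ≈-rebracket-around refl r7b refl
flip-cong r7b = ≈-rebracket-around refl r7a refl
flip-cong r8  = ≈-rebracket-around refl (≈-trans r8 (≈-sym C13₃-C23₃-comm)) refl
flip-cong r9  = ≈-rebracket-around refl r9 refl

flip-cong≅ : ∀ {a b a' b'} {f : Tm a b} {g : Tm a' b'} → f ≅ g → flip f ≅ flip g
flip-cong≅ (mk≅ refl refl e) = ≈⇒≅ (flip-cong e)

-- Decomposing Δ

interleave : ∀ a a' c c' → Tm (a + ((a' + c) + c')) (a + ((c + a') + c'))
interleave a a' c c' = id a ⊗ (σ a' c ⊗ id c')

interleave-dom : ∀ a a' c c' → (a + a') + (c + c') ≡ a + ((a' + c) + c')
interleave-dom = solve-∀

interleave-cod : ∀ a a' c c' → a + ((c + a') + c') ≡ (a + c) + (a' + c')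
interleave-cod = solve-∀

interleave-unitary : ∀ a a' c c' → interleave a a' c c' ⨾ flip (interleave a a' c c') ≈ id (a + ((a' + c) + c'))
interleave-unitary a a' c c' =
  ≈-trans (≈-sym interchange) (≈-trans (⊗-cong idˡ (⊗id-involutive' σ-inv)) ⊗-id)
  where
  ⊗id-involutive' : σ a' c ⨾ σ c a' ≈ id (a' + c) → (σ a' c ⊗ id c') ⨾ (σ c a' ⊗ id c') ≈ id ((a' + c) + c')
  ⊗id-involutive' σσ = ≈-trans (≈-sym interchange) (≈-trans (⊗-cong σσ idˡ) ⊗-id)

Δ-suc : ∀ k → Δ (suc k) ≅ (Δ k ⊗ Δ₁) ⨾[ interleave-dom k k 1 1 ] interleave k k 1 1
Δ-suc zero = ≅-sym (≅-trans (⨾[]-elim (interleave-dom 0 0 1 1) ⊗-unitˡ≅ interleave₀₀₁₁) idʳ≅)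
  where
  interleave₀₀₁₁ : interleave 0 0 1 1 ≅ id 2
  interleave₀₀₁₁ = ≅-trans ⊗-unitˡ≅ (≅-trans (⊗≅ σ-unitˡ≅ ≅-refl) ⊗-id≅)
Δ-suc (suc k) = castˡ (⨾≅ ≅-refl (castˡ {f = interleave (suc k) (suc k) 1 1} (castʳ ≅-refl)))

-- The two ways of computing Δ (a + suc c) both end in the permutation sortₓ ⨾ sortᵧ,
-- which carries the wires a, a, c, c, 1, 1 of Δ a ⊗ (Δ c ⊗ Δ₁) to a, c, 1, a, c, 1.
module Interleave-suc (a c : ℕ) where

  sortₓ : Tm (a + ((a + c) + ((c + 1) + 1))) (a + ((c + a) + ((1 + c) + 1)))
  sortₓ = id a ⊗ (σ a c ⊗ (σ c 1 ⊗ id 1))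

  sortᵧ : Tm (a + (c + ((a + 1) + (c + 1)))) (a + (c + ((1 + a) + (c + 1))))
  sortᵧ = id a ⊗ (id c ⊗ (σ a 1 ⊗ (id c ⊗ id 1)))

  sort-mid : a + ((c + a) + ((1 + c) + 1)) ≡ a + (c + ((a + 1) + (c + 1)))
  sort-mid = solve (a ∷ c ∷ [])

  mid-left : (a + ((c + a) + c)) + (1 + 1) ≡ (a + c) + (((a + c) + 1) + 1)
  mid-left = solve (a ∷ c ∷ [])

  mid-right : (a + a) + (c + ((1 + c) + 1)) ≡ a + ((a + suc c) + suc c)
  mid-right = solve (a ∷ c ∷ [])

  dom-split : (a + a) + ((c + c) + (1 + 1)) ≡ a + ((a + c) + ((c + 1) + 1))
  dom-split = solve (a ∷ c ∷ [])

  interleave-then-interleave₁ :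
    (interleave a a c c ⊗ id 2) ⨾[ mid-left ] interleave (a + c) (a + c) 1 1 ≅ sortₓ ⨾[ sort-mid ] sortᵧ
  interleave-then-interleave₁ =
    ≅-trans (⨾[]≅ mid-left mid-left′ ≅-refl interleave₁-split)
    (≅-trans (⨾[]-assoc⁻ mid-left′ (cong ((a + c) +_) (cong (_+ 1) (sym (+-assoc a 1 c)))))
    (⨾[]≅ _ sort-mid sortₓ-left sortᵧ-left))
    where
    mid-left′ : (a + ((c + a) + c)) + (1 + 1) ≡ (a + c) + ((a + (c + 1)) + 1)
    mid-left′ = solve (a ∷ c ∷ [])

    interleave₁-split : interleave (a + c) (a + c) 1 1
      ≅ (id (a + c) ⊗ ((id a ⊗ σ c 1) ⊗ id 1)) ⨾[ cong ((a + c) +_) (cong (_+ 1) (sym (+-assoc a 1 c))) ]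
        (id (a + c) ⊗ ((σ a 1 ⊗ id c) ⊗ id 1))
    interleave₁-split = ≅-trans (⊗≅ ≅-refl (⊗≅ σ-hexagon′ ≅-refl))
                          (≅-trans (⊗≅ ≅-refl (⨾[]-⊗id (sym (+-assoc a 1 c)))) (id⊗-⨾[] _))

    sortₓ-left : (interleave a a c c ⊗ id 2) ⨾[ _ ] (id (a + c) ⊗ ((id a ⊗ σ c 1) ⊗ id 1)) ≅ sortₓ
    sortₓ-left =
      ≅-trans (⨾[]≅ _ (cong (a +_) (cong ((c + a) +_) (sym (+-assoc c 1 1))))
                 (≅-trans ⊗-assoc≅ (⊗≅ ≅-refl ⊗-assoc≅))
                 (≅-trans (⊗≅ (≅-sym ⊗-id≅) ≅-refl)
                   (≅-trans ⊗-assoc≅ (⊗≅ ≅-refl (≅-trans (⊗≅ ≅-refl ⊗-assoc≅) (≅-sym ⊗-assoc≅))))))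
      (≅-trans (≅-sym (id⊗-⨾[] (cong ((c + a) +_) (sym (+-assoc c 1 1)))))
      (⊗≅ ≅-refl
         (≅-trans (⨾[]-irrelevant _ (cong₂ _+_ refl (sym (+-assoc c 1 1))))
         (≅-trans (≅-sym (⨾[]-interchange refl (sym (+-assoc c 1 1))))
           (⊗≅ (idʳ-upto ⊗-id≅) (idˡ[] (sym (+-assoc c 1 1)) ⊗-id≅))))))

    sortᵧ-left : id (a + c) ⊗ ((σ a 1 ⊗ id c) ⊗ id 1) ≅ sortᵧ
    sortᵧ-left = ≅-trans (⊗≅ (≅-sym ⊗-id≅) ≅-refl) (≅-trans ⊗-assoc≅ (⊗≅ ≅-refl (⊗≅ ≅-refl ⊗-assoc≅)))

  interleave₁-then-interleave :
    (id (a + a) ⊗ interleave c c 1 1) ⨾[ mid-right ] interleave a a (suc c) (suc c) ≅ sortₓ ⨾[ sort-mid ] sortᵧ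
  interleave₁-then-interleave =
    ≅-trans (⨾[]≅ mid-right mid-right′ ≅-refl interleave-suc-split)
    (≅-trans (⨾[]-assoc⁻ mid-right′ (cong (a +_) (cong (_+ suc c) (+-assoc c a 1))))
    (⨾[]≅ _ sort-mid sortₓ-right sortᵧ-right))
    where
    mid-right′ : (a + a) + (c + ((1 + c) + 1)) ≡ a + (((a + c) + 1) + suc c)
    mid-right′ = solve (a ∷ c ∷ [])

    interleave-suc-split : interleave a a (suc c) (suc c)
      ≅ (id a ⊗ ((σ a c ⊗ id 1) ⊗ id (suc c))) ⨾[ cong (a +_) (cong (_+ suc c) (+-assoc c a 1)) ]
        (id a ⊗ ((id c ⊗ σ a 1) ⊗ id (suc c)))
    interleave-suc-split = ≅-trans (⊗≅ ≅-refl (⊗≅ (≅-trans (σ≅ refl (+-comm 1 c)) σ-hexagon) ≅-refl))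
                             (≅-trans (⊗≅ ≅-refl (⨾[]-⊗id (+-assoc c a 1))) (id⊗-⨾[] _))

    sortₓ-right : (id (a + a) ⊗ interleave c c 1 1) ⨾[ _ ] (id a ⊗ ((σ a c ⊗ id 1) ⊗ id (suc c))) ≅ sortₓ
    sortₓ-right =
      ≅-trans (⨾[]≅ _ refl regroup-left regroup-right)
      (≅-trans (≅-sym (id⊗-⨾[] refl))
      (⊗≅ ≅-refl (≅-trans (≅-sym (⨾[]-interchange refl refl)) (⊗≅ idˡ≅ idʳ≅))))
      where
      regroup-left : id (a + a) ⊗ interleave c c 1 1 ≅ id a ⊗ (id (a + c) ⊗ (σ c 1 ⊗ id 1))
      regroup-left = ≅-trans (⊗≅ (≅-sym ⊗-id≅) ≅-refl)
                       (≅-trans ⊗-assoc≅ (⊗≅ ≅-refl (≅-trans (≅-sym ⊗-assoc≅) (⊗≅ ⊗-id≅ ≅-refl))))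
      regroup-right : id a ⊗ ((σ a c ⊗ id 1) ⊗ id (suc c)) ≅ id a ⊗ (σ a c ⊗ id ((1 + c) + 1))
      regroup-right = ⊗≅ ≅-refl (≅-trans ⊗-assoc≅ (⊗≅ ≅-refl (≅-trans ⊗-id≅ (id≅ (+-comm 1 (1 + c))))))

    sortᵧ-right : id a ⊗ ((id c ⊗ σ a 1) ⊗ id (suc c)) ≅ sortᵧ
    sortᵧ-right = ⊗≅ ≅-refl (≅-trans ⊗-assoc≅ (⊗≅ ≅-refl (⊗≅ ≅-refl (≅-trans (id≅ (+-comm 1 c)) (≅-sym ⊗-id≅)))))

Δ-+ : ∀ a c → Δ (a + c) ≅ (Δ a ⊗ Δ c) ⨾[ interleave-dom a a c c ] interleave a a c c
Δ-+ a zero = ≅-trans (Δ≅ (+-identityʳ a))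
  (≅-sym (≅-trans (⨾[]-elim (interleave-dom a a 0 0) ⊗-unitʳ≅ interleave-zero) idʳ≅))
  where
  interleave-zero : interleave a a 0 0 ≅ id (a + a)
  interleave-zero = ≅-trans (⊗≅ ≅-refl (≅-trans ⊗-unitʳ≅ σ-unitʳ≅)) ⊗-id≅
Δ-+ a (suc c) = ≅-trans via-suc-of-sum (≅-sym via-sum-with-suc)
  where
  open Interleave-suc a c
  via-suc-of-sum : Δ (a + suc c) ≅ (Δ a ⊗ (Δ c ⊗ Δ₁)) ⨾[ dom-split ] (sortₓ ⨾[ sort-mid ] sortᵧ)
  via-suc-of-sum =
    ≅-trans (Δ≅ (+-suc a c))
    (≅-trans (Δ-suc (a + c))
    (≅-trans (⨾[]≅ (interleave-dom (a + c) (a + c) 1 1) mid-left (⊗≅ (Δ-+ a c) ≅-refl) ≅-refl)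
    (≅-trans (⨾[]≅ mid-left mid-left (⨾[]-⊗ (interleave-dom a a c c)) ≅-refl)
    (≅-trans (⨾[]-assoc (cong (_+ 2) (interleave-dom a a c c)) mid-left)
    (⨾[]≅ _ dom-split ⊗-assoc≅ interleave-then-interleave₁)))))
  via-sum-with-suc : (Δ a ⊗ Δ (suc c)) ⨾[ interleave-dom a a (suc c) (suc c) ] interleave a a (suc c) (suc c)
                     ≅ (Δ a ⊗ (Δ c ⊗ Δ₁)) ⨾[ dom-split ] (sortₓ ⨾[ sort-mid ] sortᵧ)
  via-sum-with-suc =
    ≅-trans (⨾[]≅ (interleave-dom a a (suc c) (suc c)) mid-right (⊗≅ ≅-refl (Δ-suc c)) ≅-refl)
    (≅-trans (⨾[]≅ mid-right mid-right (⊗-⨾[] (interleave-dom c c 1 1)) ≅-refl)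
    (≅-trans (⨾[]-assoc (cong ((a + a) +_) (interleave-dom c c 1 1)) mid-right)
    (⨾[]≅ _ dom-split ≅-refl interleave₁-then-interleave)))

-- Copyable maps

interleave-natural : ∀ {a a' c c' b b' d d'} {f : Tm a b} {f' : Tm a' b'} {g : Tm c d} {g' : Tm c' d'}
  (p : a + ((c + a') + c') ≡ (a + c) + (a' + c')) (q : (b + b') + (d + d') ≡ b + ((b' + d) + d')) →
  interleave a a' c c' ⨾[ p ] ((f ⊗ g) ⊗ (f' ⊗ g')) ≅ ((f ⊗ f') ⊗ (g ⊗ g')) ⨾[ q ] interleave b b' d d'
interleave-natural {a} {a'} {c} {c'} {b} {b'} {d} {d'} {f} {f'} {g} {g'} p q =
  ≅-trans (⨾[]-elim p ≅-refl (≅-trans ⊗-assoc≅ (⊗≅ ≅-refl (≅-sym ⊗-assoc≅))))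
  (≅-trans (≈⇒≅ reassociated)
  (≅-sym (⨾[]-elim q (≅-trans ⊗-assoc≅ (⊗≅ ≅-refl (≅-sym ⊗-assoc≅))) ≅-refl)))
  where
  reassociated : (id a ⊗ (σ a' c ⊗ id c')) ⨾ (f ⊗ ((g ⊗ f') ⊗ g'))
                 ≈ (f ⊗ ((f' ⊗ g) ⊗ g')) ⨾ (id b ⊗ (σ b' d ⊗ id d'))
  reassociated = begin
    (id a ⊗ (σ a' c ⊗ id c')) ⨾ (f ⊗ ((g ⊗ f') ⊗ g'))
      ≈⟨ ≈-sym interchange ⟩
    (id a ⨾ f) ⊗ ((σ a' c ⊗ id c') ⨾ ((g ⊗ f') ⊗ g'))
      ≈⟨ ⊗-cong (≈-trans idˡ (≈-sym idʳ)) (≈-sym interchange) ⟩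
    (f ⨾ id b) ⊗ ((σ a' c ⨾ (g ⊗ f')) ⊗ (id c' ⨾ g'))
      ≈⟨ ⊗-cong ≈-refl (⊗-cong (≈-sym σ-nat) (≈-trans idˡ (≈-sym idʳ))) ⟩
    (f ⨾ id b) ⊗ (((f' ⊗ g) ⨾ σ b' d) ⊗ (g' ⨾ id d'))
      ≈⟨ ⊗-cong ≈-refl interchange ⟩
    (f ⨾ id b) ⊗ (((f' ⊗ g) ⊗ g') ⨾ (σ b' d ⊗ id d'))
      ≈⟨ interchange ⟩
    (f ⊗ ((f' ⊗ g) ⊗ g')) ⨾ (id b ⊗ (σ b' d ⊗ id d')) ∎

ΔNatural : ∀ {a b} → Tm a b → Set
ΔNatural {a} {b} f = f ⨾ Δ b ≈ Δ a ⨾ (f ⊗ f)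

ΔTranspose : ∀ {a b} → Tm a b → Set
ΔTranspose {a} {b} f = Δ a ⨾ (f ⊗ id a) ≈ f ⨾ Δ b ⨾ (id b ⊗ flip f)

Copyable : ∀ {a b} → Tm a b → Set
Copyable f = ΔNatural f × ΔTranspose f

ΔNatural-⨾ : ∀ {a b c} {g : Tm a b} {h : Tm b c} → ΔNatural g → ΔNatural h → ΔNatural (g ⨾ h)
ΔNatural-⨾ {a} {b} {c} {g} {h} ng nh = begin
  (g ⨾ h) ⨾ Δ c             ≈⟨ ⨾-assoc ⟩
  g ⨾ (h ⨾ Δ c)             ≈⟨ ≈-right nh ⟩
  g ⨾ (Δ b ⨾ (h ⊗ h))       ≈⟨ ≈-sym ⨾-assoc ⟩
  (g ⨾ Δ b) ⨾ (h ⊗ h)       ≈⟨ ≈-left ng ⟩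
  (Δ a ⨾ (g ⊗ g)) ⨾ (h ⊗ h) ≈⟨ ⨾-assoc ⟩
  Δ a ⨾ ((g ⊗ g) ⨾ (h ⊗ h)) ≈⟨ ≈-right (≈-sym interchange) ⟩
  Δ a ⨾ ((g ⨾ h) ⊗ (g ⨾ h)) ∎

ΔTranspose-⨾ : ∀ {a b c} {g : Tm a b} {h : Tm b c} → ΔTranspose g → ΔTranspose h → ΔTranspose (g ⨾ h)
ΔTranspose-⨾ {a} {b} {c} {g} {h} pg ph = begin
  Δ a ⨾ ((g ⨾ h) ⊗ id a)                             
    ≈⟨ ≈-right ⨾-⊗id ⟩
  Δ a ⨾ ((g ⊗ id a) ⨾ (h ⊗ id a))                    
    ≈⟨ ≈-sym ⨾-assoc ⟩
  (Δ a ⨾ (g ⊗ id a)) ⨾ (h ⊗ id a)                    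
    ≈⟨ ≈-left pg ⟩
  (g ⨾ Δ b ⨾ (id b ⊗ flip g)) ⨾ (h ⊗ id a)           
    ≈⟨ ⨾-assoc ⟩
  (g ⨾ Δ b) ⨾ ((id b ⊗ flip g) ⨾ (h ⊗ id a))         
    ≈⟨ ≈-right (≈-sym ⊗-slide) ⟩
  (g ⨾ Δ b) ⨾ ((h ⊗ id b) ⨾ (id c ⊗ flip g))         
    ≈⟨ ≈-sym ⨾-assoc ⟩
  ((g ⨾ Δ b) ⨾ (h ⊗ id b)) ⨾ (id c ⊗ flip g)         
    ≈⟨ ≈-left ⨾-assoc ⟩
  (g ⨾ (Δ b ⨾ (h ⊗ id b))) ⨾ (id c ⊗ flip g)         
    ≈⟨ ≈-left (≈-right ph) ⟩
  (g ⨾ (h ⨾ Δ c ⨾ (id c ⊗ flip h))) ⨾ (id c ⊗ flip g)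
    ≈⟨ ≈-left (≈-trans (≈-sym ⨾-assoc) (≈-left (≈-sym ⨾-assoc))) ⟩
  ((g ⨾ h) ⨾ Δ c ⨾ (id c ⊗ flip h)) ⨾ (id c ⊗ flip g)
    ≈⟨ ⨾-assoc ⟩
  (g ⨾ h) ⨾ Δ c ⨾ ((id c ⊗ flip h) ⨾ (id c ⊗ flip g))
    ≈⟨ ≈-right (≈-sym id⊗-⨾) ⟩
  (g ⨾ h) ⨾ Δ c ⨾ (id c ⊗ flip (g ⨾ h))               ∎

ΔNatural-⊗ : ∀ {a b c d} {f : Tm a b} {g : Tm c d} → ΔNatural f → ΔNatural g → ΔNatural (f ⊗ g)
ΔNatural-⊗ {a} {b} {c} {d} {f} {g} nf ng = ≅⇒≈
  (≅-trans (⨾≅ ≅-refl (Δ-+ b d))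
  (≅-trans (⨾[]-assoc⁻ refl dom-bd)
  (≅-trans (⨾[]≅ dom-bd dom-bd (≈⇒≅ copies-natural) ≅-refl)
  (≅-trans (⨾[]-assoc refl dom-bd)
  (≅-trans (⨾[]≅ refl dom-ac ≅-refl (≅-sym (interleave-natural {f = f} {f' = f} {g = g} {g' = g} cod-ac dom-bd)))
  (≅-trans (⨾[]-assoc⁻ dom-ac cod-ac)
  (⨾[]-elim cod-ac (≅-sym (Δ-+ a c)) ≅-refl)))))))
  where
  dom-ac = interleave-dom a a c c
  dom-bd = interleave-dom b b d d
  cod-ac = interleave-cod a a c c
  copies-natural : (f ⊗ g) ⨾ (Δ b ⊗ Δ d) ≈ (Δ a ⊗ Δ c) ⨾ ((f ⊗ f) ⊗ (g ⊗ g))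
  copies-natural = ≈-trans (≈-sym interchange) (≈-trans (⊗-cong nf ng) interchange)

ΔTranspose-⊗ : ∀ {a b c d} {f : Tm a b} {g : Tm c d} → ΔTranspose f → ΔTranspose g → ΔTranspose (f ⊗ g)
ΔTranspose-⊗ {a} {b} {c} {d} {f} {g} pf pg = ≅⇒≈
  (≅-trans (⨾[]≅ refl cod-ac (Δ-+ a c) (⊗≅ (≅-refl {f = f ⊗ g}) (≅-sym (⊗-id≅ {a} {c}))))
  (≅-trans (⨾[]-assoc dom-ac cod-ac)
  (≅-trans (⨾[]≅ dom-ac refl ≅-refl (interleave-natural {f = f} {f' = id a} {g = g} {g' = id c} cod-ac dom-mixed))
  (≅-trans (⨾[]-assoc⁻ refl dom-mixed)
  (≅-trans (⨾[]≅ dom-mixed dom-mixed (≈⇒≅ copies-transpose) ≅-refl)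
  (≅-trans (⨾[]-assoc refl dom-mixed)
  (≅-trans (⨾[]≅ refl dom-bd ≅-refl
             (≅-sym (interleave-natural {f = id b} {f' = flip f} {g = id d} {g' = flip g} cod-bd dom-mixed)))
  (≅-trans (⨾[]-assoc refl dom-bd)
  (≅-trans (⨾≅ ≅-refl (⨾[]-assoc⁻ dom-bd cod-bd))
  (≅-trans (⨾≅ ≅-refl (⨾[]-elim cod-bd (≅-sym (Δ-+ b d)) (⊗≅ ⊗-id≅ ≅-refl)))
  (≅-sym ⨾-assoc≅)))))))))))
  where
  dom-ac = interleave-dom a a c c
  dom-bd = interleave-dom b b d d
  dom-mixed = interleave-dom b a d c
  cod-ac = interleave-cod a a c c
  cod-bd = interleave-cod b b d d
  copies-transpose : (Δ a ⊗ Δ c) ⨾ ((f ⊗ id a) ⊗ (g ⊗ id c))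
                     ≈ ((f ⊗ g) ⨾ (Δ b ⊗ Δ d)) ⨾ ((id b ⊗ flip f) ⊗ (id d ⊗ flip g))
  copies-transpose = ≈-trans (≈-sym interchange) (≈-trans (⊗-cong pf pg) (≈-trans interchange (≈-left interchange)))

Copyable-resp-≅ : ∀ {a b a' b'} {f : Tm a b} {g : Tm a' b'} → f ≅ g → Copyable f → Copyable g
Copyable-resp-≅ (mk≅ refl refl e) (nf , pf) =
  ≈-trans (≈-left (≈-sym e)) (≈-trans nf (≈-right (⊗-cong e e))) ,
  ≈-trans (≈-right (⊗-cong (≈-sym e) ≈-refl)) (≈-trans pf (⨾-cong (≈-left e) (⊗-cong ≈-refl (flip-cong e))))

Copyable-id : ∀ {a} → Copyable (id a)
Copyable-id = ≈-trans idˡ (≈-trans (≈-sym idʳ) (≈-right (≈-sym ⊗-id))) , ≈-sym (≈-left idˡ)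

Copyable-⨾ : ∀ {a b c} {g : Tm a b} {h : Tm b c} → Copyable g → Copyable h → Copyable (g ⨾ h)
Copyable-⨾ (ng , pg) (nh , ph) = ΔNatural-⨾ ng nh , ΔTranspose-⨾ pg ph

Copyable-⊗ : ∀ {a b c d} {f : Tm a b} {g : Tm c d} → Copyable f → Copyable g → Copyable (f ⊗ g)
Copyable-⊗ (nf , pf) (ng , pg) = ΔNatural-⊗ nf ng , ΔTranspose-⊗ pf pg

Copyable-⨾[] : ∀ {a b b' c} {f : Tm a b} {g : Tm b' c} (p : b ≡ b') → Copyable f → Copyable g → Copyable (f ⨾[ p ] g)
Copyable-⨾[] {g = g} p cf cg = Copyable-⨾ cf (Copyable-resp-≅ (≅cast (sym p) refl g) cg)

ΔNatural∧unitary⇒ΔTranspose : ∀ {a b} {f : Tm a b} → ΔNatural f → f ⨾ flip f ≈ id a → ΔTranspose f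
ΔNatural∧unitary⇒ΔTranspose {a} {b} {f} nf ff = ≈-sym (begin
  f ⨾ Δ b ⨾ (id b ⊗ flip f)         ≈⟨ ≈-left nf ⟩
  Δ a ⨾ (f ⊗ f) ⨾ (id b ⊗ flip f)   ≈⟨ ⨾-assoc ⟩
  Δ a ⨾ ((f ⊗ f) ⨾ (id b ⊗ flip f)) ≈⟨ ≈-right (≈-sym interchange) ⟩
  Δ a ⨾ ((f ⨾ id b) ⊗ (f ⨾ flip f)) ≈⟨ ≈-right (⊗-cong idʳ ff) ⟩
  Δ a ⨾ (f ⊗ id a)                  ∎)

-- The generators are copyable

ket0⊗id-expand : ket0 ⊗ id 1 ≈ (ket1 ⊗ ket1 ⊗ id 1) ⨾ C12₃ ⨾ (bra1 ⊗ id 2)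
ket0⊗id-expand = begin
  ket0 ⊗ id 1
    ≈⟨ ⨾-⊗id ⟩
  ((ket1 ⊗ ket1) ⨾ cnot) ⊗ id 1 ⨾ (bra1 ⊗ id 1) ⊗ id 1
    ≈⟨ ≈-left ⨾-⊗id ⟩
  ((ket1 ⊗ ket1) ⊗ id 1) ⨾ (cnot ⊗ id 1) ⨾ (bra1 ⊗ id 1) ⊗ id 1
    ≈⟨ ⨾-cong (⨾-cong ⊗-assoc ≈-refl) (≈-trans ⊗-assoc (⊗-cong ≈-refl ⊗-id)) ⟩
  (ket1 ⊗ ket1 ⊗ id 1) ⨾ C12₃ ⨾ (bra1 ⊗ id 2) ∎

bra1⊗id-cnot : (bra1 ⊗ id 2) ⨾ cnot ≈ C23₃ ⨾ (bra1 ⊗ id 2)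
bra1⊗id-cnot = ≈-trans (≈-right (≈-sym ⊗-unitˡ)) ⊗-slide

ket0-control : (ket0 ⊗ id 1) ⨾ cnot ≈ ket0 ⊗ id 1
ket0-control = begin
  (ket0 ⊗ id 1) ⨾ cnot                                   ≈⟨ ≈-left ket0⊗id-expand ⟩
  ((ket1 ⊗ ket1 ⊗ id 1) ⨾ C12₃ ⨾ (bra1 ⊗ id 2)) ⨾ cnot   ≈⟨ ⨾-assoc ⟩
  ((ket1 ⊗ ket1 ⊗ id 1) ⨾ C12₃) ⨾ ((bra1 ⊗ id 2) ⨾ cnot) ≈⟨ ≈-right bra1⊗id-cnot ⟩
  ((ket1 ⊗ ket1 ⊗ id 1) ⨾ C12₃) ⨾ (C23₃ ⨾ (bra1 ⊗ id 2)) ≈⟨ ≈-sym ⨾-assoc ⟩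
  (ket1 ⊗ ket1 ⊗ id 1) ⨾ C12₃ ⨾ C23₃ ⨾ (bra1 ⊗ id 2)     ≈⟨ r7a ⟩
  (ket1 ⊗ ket1 ⊗ id 1) ⨾ C12₃ ⨾ (bra1 ⊗ id 2)            ≈⟨ ≈-sym ket0⊗id-expand ⟩
  ket0 ⊗ id 1                                            ∎

ket1⨾ket1⊗id : ket1 ⨾ (ket1 ⊗ id 1) ≈ ket1 ⊗ ket1
ket1⨾ket1⊗id = ≈-trans (≈-left (≈-sym ⊗-unitˡ)) ⊗-merge′

ket1ket1-cnot-absorbs : (ket1 ⊗ ket1) ⨾ cnot ⨾ (bra1 ⊗ id 1) ⨾ (ket1 ⊗ id 1) ≈ (ket1 ⊗ ket1) ⨾ cnot
ket1ket1-cnot-absorbs = begin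
  (ket1 ⊗ ket1) ⨾ cnot ⨾ (bra1 ⊗ id 1) ⨾ (ket1 ⊗ id 1)
    ≈⟨ ≈-left (≈-left (≈-left (≈-sym ket1⨾ket1⊗id))) ⟩
  (ket1 ⨾ (ket1 ⊗ id 1)) ⨾ cnot ⨾ (bra1 ⊗ id 1) ⨾ (ket1 ⊗ id 1)
    ≈⟨ ≈-rebracket refl ⟩
  ket1 ⨾ ((ket1 ⊗ id 1) ⨾ cnot ⨾ (bra1 ⊗ id 1) ⨾ (ket1 ⊗ id 1))
    ≈⟨ ≈-right (≈-sym r4a) ⟩
  ket1 ⨾ ((ket1 ⊗ id 1) ⨾ cnot)
    ≈⟨ ≈-sym ⨾-assoc ⟩
  (ket1 ⨾ (ket1 ⊗ id 1)) ⨾ cnot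
    ≈⟨ ≈-left ket1⨾ket1⊗id ⟩
  (ket1 ⊗ ket1) ⨾ cnot ∎

ket0⨾ket1⊗id : ket0 ⨾ (ket1 ⊗ id 1) ≈ ket1 ⊗ ket0
ket0⨾ket1⊗id = ≈-trans (≈-left (≈-sym ⊗-unitˡ)) ⊗-merge′

ket1ket1-cnot : (ket1 ⊗ ket1) ⨾ cnot ≈ ket1 ⊗ ket0
ket1ket1-cnot = ≈-trans (≈-sym ket1ket1-cnot-absorbs) ket0⨾ket1⊗id

bra0 : Tm 1 0
bra0 = flip ket0

ket0⨾bra0 : ket0 ⨾ bra0 ≈ id 0
ket0⨾bra0 = begin
  ket0 ⨾ bra0
    ≈⟨ ≈-rebracket refl ⟩
  ((ket1 ⊗ ket1) ⨾ cnot ⨾ (bra1 ⊗ id 1) ⨾ (ket1 ⊗ id 1)) ⨾ (cnot ⨾ (bra1 ⊗ bra1))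
    ≈⟨ ≈-left ket1ket1-cnot-absorbs ⟩
  ((ket1 ⊗ ket1) ⨾ cnot) ⨾ (cnot ⨾ (bra1 ⊗ bra1))
    ≈⟨ ≈-rebracket refl ⟩
  (ket1 ⊗ ket1) ⨾ (cnot ⨾ cnot) ⨾ (bra1 ⊗ bra1)
    ≈⟨ ≈-middle r2 ⟩
  (ket1 ⊗ ket1) ⨾ id 2 ⨾ (bra1 ⊗ bra1)
    ≈⟨ ≈-left idʳ ⟩
  (ket1 ⊗ ket1) ⨾ (bra1 ⊗ bra1)
    ≈⟨ ≈-sym interchange ⟩
  (ket1 ⨾ bra1) ⊗ (ket1 ⨾ bra1)
    ≈⟨ ⊗-cong r6 r6 ⟩
  id 0 ⊗ id 0
    ≈⟨ ⊗-id ⟩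
  id 0 ∎

C21⨾flipC21 : C21 ⨾ flip C21 ≈ id 2
C21⨾flipC21 = begin
  C21 ⨾ flip C21                                ≈⟨ ≈-rebracket refl ⟩
  σ 1 1 ⨾ cnot ⨾ (σ 1 1 ⨾ σ 1 1) ⨾ cnot ⨾ σ 1 1 ≈⟨ ≈-left (≈-left (≈-right σ-inv)) ⟩
  σ 1 1 ⨾ cnot ⨾ id 2 ⨾ cnot ⨾ σ 1 1            ≈⟨ ≈-left (≈-left idʳ) ⟩
  σ 1 1 ⨾ cnot ⨾ cnot ⨾ σ 1 1                   ≈⟨ ≈-rebracket refl ⟩
  σ 1 1 ⨾ (cnot ⨾ cnot) ⨾ σ 1 1                 ≈⟨ ≈-middle r2 ⟩
  σ 1 1 ⨾ id 2 ⨾ σ 1 1                          ≈⟨ ≈-left idʳ ⟩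
  σ 1 1 ⨾ σ 1 1                                 ≈⟨ σ-inv ⟩
  id 2                                          ∎

Δ₁⨾∇₁ : Δ₁ ⨾ ∇ 1 ≈ id 1
Δ₁⨾∇₁ = begin
  Δ₁ ⨾ ∇ 1                                         ≈⟨ ≈-rebracket refl ⟩
  (ket0 ⊗ id 1) ⨾ (C21 ⨾ flip C21) ⨾ (bra0 ⊗ id 1) ≈⟨ ≈-middle C21⨾flipC21 ⟩
  (ket0 ⊗ id 1) ⨾ id 2 ⨾ (bra0 ⊗ id 1)             ≈⟨ ≈-left idʳ ⟩
  (ket0 ⊗ id 1) ⨾ (bra0 ⊗ id 1)                    ≈⟨ ≈-sym interchange ⟩
  (ket0 ⨾ bra0) ⊗ (id 1 ⨾ id 1)                    ≈⟨ ⊗-cong ket0⨾bra0 idˡ ⟩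
  id 0 ⊗ id 1                                      ≈⟨ ⊗-unitˡ ⟩
  id 1                                             ∎

ket1-ΔNatural : ket1 ⨾ Δ₁ ≈ id 0 ⨾ (ket1 ⊗ ket1)
ket1-ΔNatural = begin
  ket1 ⨾ Δ₁
    ≈⟨ ≈-rebracket refl ⟩
  (ket1 ⨾ (ket0 ⊗ id 1)) ⨾ σ 1 1 ⨾ cnot ⨾ σ 1 1
    ≈⟨ ≈-left (≈-left (≈-left (≈-trans (≈-left (≈-sym ⊗-unitˡ)) ⊗-merge′))) ⟩
  (ket0 ⊗ ket1) ⨾ σ 1 1 ⨾ cnot ⨾ σ 1 1
    ≈⟨ ≈-left (≈-left (≈-trans σ-nat (≈-trans (≈-left σ-unit) idˡ))) ⟩
  (ket1 ⊗ ket0) ⨾ cnot ⨾ σ 1 1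
    ≈⟨ ≈-left (≈-left (≈-sym ket1ket1-cnot)) ⟩
  (ket1 ⊗ ket1) ⨾ cnot ⨾ cnot ⨾ σ 1 1
    ≈⟨ ≈-rebracket refl ⟩
  (ket1 ⊗ ket1) ⨾ (cnot ⨾ cnot) ⨾ σ 1 1
    ≈⟨ ≈-middle r2 ⟩
  (ket1 ⊗ ket1) ⨾ id 2 ⨾ σ 1 1
    ≈⟨ ≈-left idʳ ⟩
  (ket1 ⊗ ket1) ⨾ σ 1 1
    ≈⟨ ≈-trans σ-nat (≈-trans (≈-left σ-unit) idˡ) ⟩
  ket1 ⊗ ket1
    ≈⟨ ≈-sym idˡ ⟩
  id 0 ⨾ (ket1 ⊗ ket1) ∎

ket0⊗id-σ : (ket0 ⊗ id 1) ⨾ σ 1 1 ≈ id 1 ⊗ ket0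
ket0⊗id-σ = ≈-trans σ-nat (≈-trans (≈-left σ₀₁) idˡ)

id⊗ket0-σ : (id 1 ⊗ ket0) ⨾ σ 1 1 ≈ ket0 ⊗ id 1
id⊗ket0-σ = ≈-trans σ-nat (≈-trans (≈-left σ-unit) idˡ)

cnot-σ : cnot ⨾ σ 1 1 ≈ C21 ⨾ cnot
cnot-σ = begin
  cnot ⨾ σ 1 1               ≈⟨ ≈-right (≈-sym r1) ⟩
  cnot ⨾ (cnot ⨾ C21 ⨾ cnot) ≈⟨ ≈-rebracket refl ⟩
  (cnot ⨾ cnot) ⨾ C21 ⨾ cnot ≈⟨ ≈-left (≈-left r2) ⟩
  id 2 ⨾ C21 ⨾ cnot          ≈⟨ ≈-left idˡ ⟩
  C21 ⨾ cnot                 ∎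

Δ₁-via-cnot : Δ₁ ≈ (id 1 ⊗ ket0) ⨾ cnot
Δ₁-via-cnot = begin
  Δ₁                                            ≈⟨ ≈-rebracket refl ⟩
  ((ket0 ⊗ id 1) ⨾ σ 1 1) ⨾ cnot ⨾ σ 1 1        ≈⟨ ≈-left (≈-left ket0⊗id-σ) ⟩
  (id 1 ⊗ ket0) ⨾ cnot ⨾ σ 1 1                  ≈⟨ ⨾-assoc ⟩
  (id 1 ⊗ ket0) ⨾ (cnot ⨾ σ 1 1)                ≈⟨ ≈-right cnot-σ ⟩
  (id 1 ⊗ ket0) ⨾ (C21 ⨾ cnot)                  ≈⟨ ≈-rebracket refl ⟩
  ((id 1 ⊗ ket0) ⨾ σ 1 1) ⨾ cnot ⨾ σ 1 1 ⨾ cnot ≈⟨ ≈-left (≈-left (≈-left id⊗ket0-σ)) ⟩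
  (ket0 ⊗ id 1) ⨾ cnot ⨾ σ 1 1 ⨾ cnot           ≈⟨ ≈-left (≈-left ket0-control) ⟩
  (ket0 ⊗ id 1) ⨾ σ 1 1 ⨾ cnot                  ≈⟨ ≈-left ket0⊗id-σ ⟩
  (id 1 ⊗ ket0) ⨾ cnot                          ∎

Δ₁-cnot : Δ₁ ⨾ cnot ≈ id 1 ⊗ ket0
Δ₁-cnot = ≈-trans (≈-left Δ₁-via-cnot) (≈-trans ⨾-assoc (≈-trans (≈-right r2) idʳ))

Δ₁-cocommutative : Δ₁ ⨾ σ 1 1 ≈ Δ₁
Δ₁-cocommutative = begin
  Δ₁ ⨾ σ 1 1                                       ≈⟨ ≈-rebracket refl ⟩
  ((ket0 ⊗ id 1) ⨾ σ 1 1) ⨾ cnot ⨾ (σ 1 1 ⨾ σ 1 1) ≈⟨ ≈-right σ-inv ⟩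
  ((ket0 ⊗ id 1) ⨾ σ 1 1) ⨾ cnot ⨾ id 2            ≈⟨ idʳ ⟩
  ((ket0 ⊗ id 1) ⨾ σ 1 1) ⨾ cnot                   ≈⟨ ≈-left ket0⊗id-σ ⟩
  (id 1 ⊗ ket0) ⨾ cnot                             ≈⟨ ≈-sym Δ₁-via-cnot ⟩
  Δ₁                                               ∎

cnot-bra1bra1 : cnot ⨾ (bra1 ⊗ bra1) ≈ (bra1 ⊗ id 1) ⨾ bra0
cnot-bra1bra1 = begin
  cnot ⨾ (bra1 ⊗ bra1)                                                   ≈⟨ ≈-right (≈-sym ⊗-merge) ⟩
  cnot ⨾ ((bra1 ⊗ id 1) ⨾ (id 0 ⊗ bra1))                                 ≈⟨ ≈-sym ⨾-assoc ⟩
  (cnot ⨾ (bra1 ⊗ id 1)) ⨾ (id 0 ⊗ bra1)                                 ≈⟨ ≈-left r4b ⟩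
  ((bra1 ⊗ id 1) ⨾ (ket1 ⊗ id 1) ⨾ cnot ⨾ (bra1 ⊗ id 1)) ⨾ (id 0 ⊗ bra1) ≈⟨ ≈-rebracket refl ⟩
  (bra1 ⊗ id 1) ⨾ (ket1 ⊗ id 1) ⨾ cnot ⨾ ((bra1 ⊗ id 1) ⨾ (id 0 ⊗ bra1)) ≈⟨ ≈-right ⊗-merge ⟩
  (bra1 ⊗ id 1) ⨾ (ket1 ⊗ id 1) ⨾ cnot ⨾ (bra1 ⊗ bra1)                   ≈⟨ ≈-rebracket refl ⟩
  (bra1 ⊗ id 1) ⨾ bra0                                                   ∎

σ-bra1bra1 : σ 1 1 ⨾ (bra1 ⊗ bra1) ≈ bra1 ⊗ bra1
σ-bra1bra1 = ≈-trans (≈-sym σ-nat) (≈-trans (≈-right σ-unit) idʳ)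

σ-bra1⊗id : σ 1 1 ⨾ (bra1 ⊗ id 1) ≈ id 1 ⊗ bra1
σ-bra1⊗id = ≈-trans (≈-sym σ-nat) (≈-trans (≈-right σ-unit) idʳ)

σ-id⊗bra1 : σ 1 1 ⨾ (id 1 ⊗ bra1) ≈ bra1 ⊗ id 1
σ-id⊗bra1 = ≈-trans (≈-sym σ-nat) (≈-trans (≈-right σ₀₁) idʳ)

ket0⊗id-id⊗bra1 : (ket0 ⊗ id 1) ⨾ (id 1 ⊗ bra1) ≈ bra1 ⨾ ket0
ket0⊗id-id⊗bra1 = ≈-trans ⊗-slide (⨾-cong ⊗-unitˡ ⊗-unitʳ)

bra1-ΔNatural : bra1 ⨾ id 0 ≈ Δ₁ ⨾ (bra1 ⊗ bra1)
bra1-ΔNatural = ≈-sym (begin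
  Δ₁ ⨾ (bra1 ⊗ bra1)                                       ≈⟨ ≈-rebracket refl ⟩
  (ket0 ⊗ id 1) ⨾ (σ 1 1 ⨾ cnot ⨾ (σ 1 1 ⨾ (bra1 ⊗ bra1))) ≈⟨ ≈-right (≈-right σ-bra1bra1) ⟩
  (ket0 ⊗ id 1) ⨾ (σ 1 1 ⨾ cnot ⨾ (bra1 ⊗ bra1))           ≈⟨ ≈-right ⨾-assoc ⟩
  (ket0 ⊗ id 1) ⨾ (σ 1 1 ⨾ (cnot ⨾ (bra1 ⊗ bra1)))         ≈⟨ ≈-right (≈-right cnot-bra1bra1) ⟩
  (ket0 ⊗ id 1) ⨾ (σ 1 1 ⨾ ((bra1 ⊗ id 1) ⨾ bra0))         ≈⟨ ≈-right (≈-sym ⨾-assoc) ⟩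
  (ket0 ⊗ id 1) ⨾ ((σ 1 1 ⨾ (bra1 ⊗ id 1)) ⨾ bra0)         ≈⟨ ≈-right (≈-left σ-bra1⊗id) ⟩
  (ket0 ⊗ id 1) ⨾ ((id 1 ⊗ bra1) ⨾ bra0)                   ≈⟨ ≈-sym ⨾-assoc ⟩
  ((ket0 ⊗ id 1) ⨾ (id 1 ⊗ bra1)) ⨾ bra0                   ≈⟨ ≈-left ket0⊗id-id⊗bra1 ⟩
  (bra1 ⨾ ket0) ⨾ bra0                                     ≈⟨ ⨾-assoc ⟩
  bra1 ⨾ (ket0 ⨾ bra0)                                     ≈⟨ ≈-right ket0⨾bra0 ⟩
  bra1 ⨾ id 0                                              ∎)

ket1-ΔTranspose : id 0 ⨾ (ket1 ⊗ id 0) ≈ ket1 ⨾ Δ₁ ⨾ (id 1 ⊗ bra1)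
ket1-ΔTranspose = ≈-sym (begin
  ket1 ⨾ Δ₁ ⨾ (id 1 ⊗ bra1)            ≈⟨ ≈-left ket1-ΔNatural ⟩
  id 0 ⨾ (ket1 ⊗ ket1) ⨾ (id 1 ⊗ bra1) ≈⟨ ≈-left idˡ ⟩
  (ket1 ⊗ ket1) ⨾ (id 1 ⊗ bra1)        ≈⟨ ≈-sym interchange ⟩
  (ket1 ⨾ id 1) ⊗ (ket1 ⨾ bra1)        ≈⟨ ⊗-cong idʳ r6 ⟩
  ket1 ⊗ id 0                          ≈⟨ ≈-sym idˡ ⟩
  id 0 ⨾ (ket1 ⊗ id 0)                 ∎)

bra1-ΔTranspose : Δ₁ ⨾ (bra1 ⊗ id 1) ≈ bra1 ⨾ id 0 ⨾ (id 0 ⊗ ket1)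
bra1-ΔTranspose = begin
  Δ₁ ⨾ (bra1 ⊗ id 1)
    ≈⟨ ≈-left (≈-sym Δ₁-cocommutative) ⟩
  Δ₁ ⨾ σ 1 1 ⨾ (bra1 ⊗ id 1)
    ≈⟨ ⨾-assoc ⟩
  Δ₁ ⨾ (σ 1 1 ⨾ (bra1 ⊗ id 1))
    ≈⟨ ≈-right σ-bra1⊗id ⟩
  Δ₁ ⨾ (id 1 ⊗ bra1)
    ≈⟨ ≈-rebracket refl ⟩
  (ket0 ⊗ id 1) ⨾ σ 1 1 ⨾ cnot ⨾ (σ 1 1 ⨾ (id 1 ⊗ bra1))
    ≈⟨ ≈-right σ-id⊗bra1 ⟩
  (ket0 ⊗ id 1) ⨾ σ 1 1 ⨾ cnot ⨾ (bra1 ⊗ id 1)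
    ≈⟨ ⨾-assoc ⟩
  (ket0 ⊗ id 1) ⨾ σ 1 1 ⨾ (cnot ⨾ (bra1 ⊗ id 1))
    ≈⟨ ≈-right r4b ⟩
  (ket0 ⊗ id 1) ⨾ σ 1 1 ⨾ ((bra1 ⊗ id 1) ⨾ (ket1 ⊗ id 1) ⨾ cnot ⨾ (bra1 ⊗ id 1))
    ≈⟨ ≈-rebracket refl ⟩
  (ket0 ⊗ id 1) ⨾ (σ 1 1 ⨾ (bra1 ⊗ id 1)) ⨾ (ket1 ⊗ id 1) ⨾ cnot ⨾ (bra1 ⊗ id 1)
    ≈⟨ ≈-left (≈-left (≈-left (≈-right σ-bra1⊗id))) ⟩
  (ket0 ⊗ id 1) ⨾ (id 1 ⊗ bra1) ⨾ (ket1 ⊗ id 1) ⨾ cnot ⨾ (bra1 ⊗ id 1)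
    ≈⟨ ≈-left (≈-left (≈-left ket0⊗id-id⊗bra1)) ⟩
  (bra1 ⨾ ket0) ⨾ (ket1 ⊗ id 1) ⨾ cnot ⨾ (bra1 ⊗ id 1)
    ≈⟨ ≈-rebracket refl ⟩
  bra1 ⨾ (ket0 ⨾ (ket1 ⊗ id 1)) ⨾ cnot ⨾ (bra1 ⊗ id 1)
    ≈⟨ ≈-left (≈-left (≈-right ket0⨾ket1⊗id)) ⟩
  bra1 ⨾ (ket1 ⊗ ket0) ⨾ cnot ⨾ (bra1 ⊗ id 1)
    ≈⟨ ≈-left (≈-left (≈-right (≈-sym ket1ket1-cnot))) ⟩
  bra1 ⨾ ((ket1 ⊗ ket1) ⨾ cnot) ⨾ cnot ⨾ (bra1 ⊗ id 1)
    ≈⟨ ≈-rebracket refl ⟩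
  bra1 ⨾ (ket1 ⊗ ket1) ⨾ (cnot ⨾ cnot) ⨾ (bra1 ⊗ id 1)
    ≈⟨ ≈-middle r2 ⟩
  bra1 ⨾ (ket1 ⊗ ket1) ⨾ id 2 ⨾ (bra1 ⊗ id 1)
    ≈⟨ ≈-left idʳ ⟩
  bra1 ⨾ (ket1 ⊗ ket1) ⨾ (bra1 ⊗ id 1)
    ≈⟨ ⨾-assoc ⟩
  bra1 ⨾ ((ket1 ⊗ ket1) ⨾ (bra1 ⊗ id 1))
    ≈⟨ ≈-right (≈-trans (≈-sym interchange) (≈-trans (⊗-cong r6 idʳ) ⊗-unitˡ)) ⟩
  bra1 ⨾ ket1
    ≈⟨ ≈-left (≈-sym idʳ) ⟩
  bra1 ⨾ id 0 ⨾ ket1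
    ≈⟨ ≈-right (≈-sym ⊗-unitˡ) ⟩
  bra1 ⨾ id 0 ⨾ (id 0 ⊗ ket1) ∎

⊗id-⊗id : ∀ {f : Tm 2 2} → (f ⊗ id 1) ⊗ id 1 ≈ f ⊗ id 2
⊗id-⊗id = ≈-trans ⊗-assoc (⊗-cong ≈-refl ⊗-id)

id⊗-id⊗ : ∀ {f : Tm 2 2} → id 1 ⊗ (id 1 ⊗ f) ≈ id 2 ⊗ f
id⊗-id⊗ = ≈-trans (≈-sym ⊗-assoc) (⊗-cong ⊗-id ≈-refl)

σ₁₁⊗id : Tm 3 3
σ₁₁⊗id = σ 1 1 ⊗ id 1
id⊗σ₁₁ : Tm 3 3
id⊗σ₁₁ = id 1 ⊗ σ 1 1

σ₁₁⊗id-involutive : σ₁₁⊗id ⨾ σ₁₁⊗id ≈ id 3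
σ₁₁⊗id-involutive = ⊗id-involutive σ-inv

σ₁₂-split : σ 1 2 ≈ σ₁₁⊗id ⨾ id⊗σ₁₁
σ₁₂-split = ≅⇒≈ σ-hexagon

σ₂₁-split : σ 2 1 ≈ id⊗σ₁₁ ⨾ σ₁₁⊗id
σ₂₁-split = ≅⇒≈ σ-hexagon′

C13₃-conjugate : σ₁₁⊗id ⨾ C23₃ ⨾ σ₁₁⊗id ≈ C13₃
C13₃-conjugate = begin
  σ₁₁⊗id ⨾ C23₃ ⨾ σ₁₁⊗id
    ≈⟨ ≈-middle (≈-sym idˡ) ⟩
  σ₁₁⊗id ⨾ (id 3 ⨾ C23₃) ⨾ σ₁₁⊗id
    ≈⟨ ≈-middle (≈-left (≈-sym σ-inv)) ⟩
  σ₁₁⊗id ⨾ ((σ 1 2 ⨾ σ 2 1) ⨾ C23₃) ⨾ σ₁₁⊗id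
    ≈⟨ ≈-middle ⨾-assoc ⟩
  σ₁₁⊗id ⨾ (σ 1 2 ⨾ (σ 2 1 ⨾ C23₃)) ⨾ σ₁₁⊗id
    ≈⟨ ≈-middle (≈-right (≈-sym σ-nat)) ⟩
  σ₁₁⊗id ⨾ (σ 1 2 ⨾ ((cnot ⊗ id 1) ⨾ σ 2 1)) ⨾ σ₁₁⊗id
    ≈⟨ ≈-middle (⨾-cong σ₁₂-split (≈-right σ₂₁-split)) ⟩
  σ₁₁⊗id ⨾ ((σ₁₁⊗id ⨾ id⊗σ₁₁) ⨾ ((cnot ⊗ id 1) ⨾ (id⊗σ₁₁ ⨾ σ₁₁⊗id))) ⨾ σ₁₁⊗id
    ≈⟨ ≈-rebracket refl ⟩
  (σ₁₁⊗id ⨾ σ₁₁⊗id) ⨾ id⊗σ₁₁ ⨾ (cnot ⊗ id 1) ⨾ id⊗σ₁₁ ⨾ (σ₁₁⊗id ⨾ σ₁₁⊗id)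
    ≈⟨ ⨾-cong (≈-left (≈-left (≈-left σ₁₁⊗id-involutive))) σ₁₁⊗id-involutive ⟩
  id 3 ⨾ id⊗σ₁₁ ⨾ (cnot ⊗ id 1) ⨾ id⊗σ₁₁ ⨾ id 3
    ≈⟨ ≈-trans idʳ (≈-left (≈-left idˡ)) ⟩
  id⊗σ₁₁ ⨾ (cnot ⊗ id 1) ⨾ id⊗σ₁₁ ∎

C12₃-conjugate : σ₁₁⊗id ⨾ C21₃ ⨾ σ₁₁⊗id ≈ C12₃
C12₃-conjugate = begin
  σ₁₁⊗id ⨾ C21₃ ⨾ σ₁₁⊗id
    ≈⟨ ⨾-cong (⨾-cong ≈-refl ⨾-⊗id) ≈-refl ⟩
  σ₁₁⊗id ⨾ ((σ 1 1 ⨾ cnot) ⊗ id 1 ⨾ σ 1 1 ⊗ id 1) ⨾ σ₁₁⊗id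
    ≈⟨ ≈-middle (≈-left ⨾-⊗id) ⟩
  σ₁₁⊗id ⨾ (σ₁₁⊗id ⨾ C12₃ ⨾ σ₁₁⊗id) ⨾ σ₁₁⊗id
    ≈⟨ ≈-rebracket refl ⟩
  (σ₁₁⊗id ⨾ σ₁₁⊗id) ⨾ C12₃ ⨾ (σ₁₁⊗id ⨾ σ₁₁⊗id)
    ≈⟨ ⨾-cong (≈-left σ₁₁⊗id-involutive) σ₁₁⊗id-involutive ⟩
  id 3 ⨾ C12₃ ⨾ id 3
    ≈⟨ ≈-trans idʳ idˡ ⟩
  C12₃ ∎

C12₃-C13₃-comm : C12₃ ⨾ C13₃ ≈ C13₃ ⨾ C12₃
C12₃-C13₃-comm = begin
  C12₃ ⨾ C13₃
    ≈⟨ ⨾-cong (≈-sym C12₃-conjugate) (≈-sym C13₃-conjugate) ⟩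
  (σ₁₁⊗id ⨾ C21₃ ⨾ σ₁₁⊗id) ⨾ (σ₁₁⊗id ⨾ C23₃ ⨾ σ₁₁⊗id)
    ≈⟨ conjugate-⨾ σ₁₁⊗id-involutive ⟩
  σ₁₁⊗id ⨾ (C21₃ ⨾ C23₃) ⨾ σ₁₁⊗id
    ≈⟨ ≈-middle r3 ⟩
  σ₁₁⊗id ⨾ (C23₃ ⨾ C21₃) ⨾ σ₁₁⊗id
    ≈⟨ ≈-sym (conjugate-⨾ σ₁₁⊗id-involutive) ⟩
  (σ₁₁⊗id ⨾ C23₃ ⨾ σ₁₁⊗id) ⨾ (σ₁₁⊗id ⨾ C21₃ ⨾ σ₁₁⊗id)
    ≈⟨ ⨾-cong C13₃-conjugate C12₃-conjugate ⟩
  C13₃ ⨾ C12₃ ∎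

r8′ : C12₃ ⨾ C23₃ ≈ C23₃ ⨾ C13₃ ⨾ C12₃
r8′ = begin
  C12₃ ⨾ C23₃                 ≈⟨ ≈-sym idʳ ⟩
  C12₃ ⨾ C23₃ ⨾ id 3          ≈⟨ ≈-right (≈-sym C12₃-involutive) ⟩
  C12₃ ⨾ C23₃ ⨾ (C12₃ ⨾ C12₃) ≈⟨ ≈-sym ⨾-assoc ⟩
  C12₃ ⨾ C23₃ ⨾ C12₃ ⨾ C12₃   ≈⟨ ≈-left r8 ⟩
  C23₃ ⨾ C13₃ ⨾ C12₃          ∎

ket0-mid : Tm 2 3
ket0-mid = id 1 ⊗ (ket0 ⊗ id 1)

ket0-mid-C23 : ket0-mid ⨾ C23₃ ≈ ket0-mid
ket0-mid-C23 = ≈-trans (≈-sym id⊗-⨾) (⊗-cong ≈-refl ket0-control)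

id₂⊗ket0 : id 2 ⊗ ket0 ≈ id 1 ⊗ (id 1 ⊗ ket0)
id₂⊗ket0 = ≈-trans (⊗-cong (≈-sym ⊗-id) ≈-refl) ⊗-assoc

ket0-mid-σ : ket0-mid ⨾ id⊗σ₁₁ ≈ id 2 ⊗ ket0
ket0-mid-σ = ≈-trans (≈-sym id⊗-⨾) (≈-trans (⊗-cong ≈-refl ket0⊗id-σ) (≈-sym id₂⊗ket0))

id₂⊗ket0-σ : (id 2 ⊗ ket0) ⨾ id⊗σ₁₁ ≈ ket0-mid
id₂⊗ket0-σ = ≈-trans (≈-left id₂⊗ket0) (≈-trans (≈-sym id⊗-⨾) (⊗-cong ≈-refl id⊗ket0-σ))

cnot-id⊗ket0 : cnot ⨾ (id 2 ⊗ ket0) ≈ (id 2 ⊗ ket0) ⨾ C12₃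
cnot-id⊗ket0 = ≈-trans (≈-left (≈-sym ⊗-unitʳ)) ⊗-slide

ket0-mid-C13 : ket0-mid ⨾ C13₃ ≈ cnot ⨾ ket0-mid
ket0-mid-C13 = begin
  ket0-mid ⨾ C13₃                              ≈⟨ ≈-rebracket refl ⟩
  (ket0-mid ⨾ id⊗σ₁₁) ⨾ (cnot ⊗ id 1) ⨾ id⊗σ₁₁ ≈⟨ ≈-left (≈-left ket0-mid-σ) ⟩
  (id 2 ⊗ ket0) ⨾ (cnot ⊗ id 1) ⨾ id⊗σ₁₁       ≈⟨ ≈-left (≈-sym cnot-id⊗ket0) ⟩
  cnot ⨾ (id 2 ⊗ ket0) ⨾ id⊗σ₁₁                ≈⟨ ⨾-assoc ⟩
  cnot ⨾ ((id 2 ⊗ ket0) ⨾ id⊗σ₁₁)              ≈⟨ ≈-right id₂⊗ket0-σ ⟩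
  cnot ⨾ ket0-mid                              ∎

Δ₁⊗id-via-ket0-mid : Δ₁ ⊗ id 1 ≈ ket0-mid ⨾ C12₃
Δ₁⊗id-via-ket0-mid = ≈-trans (⊗-cong Δ₁-via-cnot ≈-refl) (≈-trans ⨾-⊗id (≈-left ⊗-assoc))

cnot-Δ₁⊗id : cnot ⨾ (Δ₁ ⊗ id 1) ≈ (Δ₁ ⊗ id 1) ⨾ C23₃
cnot-Δ₁⊗id = begin
  cnot ⨾ (Δ₁ ⊗ id 1)              ≈⟨ ≈-right Δ₁⊗id-via-ket0-mid ⟩
  cnot ⨾ (ket0-mid ⨾ C12₃)        ≈⟨ ≈-sym ⨾-assoc ⟩
  cnot ⨾ ket0-mid ⨾ C12₃          ≈⟨ ≈-left (≈-sym ket0-mid-C13) ⟩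
  ket0-mid ⨾ C13₃ ⨾ C12₃          ≈⟨ ≈-left (≈-left (≈-sym ket0-mid-C23)) ⟩
  ket0-mid ⨾ C23₃ ⨾ C13₃ ⨾ C12₃   ≈⟨ ≈-rebracket refl ⟩
  ket0-mid ⨾ (C23₃ ⨾ C13₃ ⨾ C12₃) ≈⟨ ≈-right (≈-sym r8′) ⟩
  ket0-mid ⨾ (C12₃ ⨾ C23₃)        ≈⟨ ≈-sym ⨾-assoc ⟩
  ket0-mid ⨾ C12₃ ⨾ C23₃          ≈⟨ ≈-left (≈-sym Δ₁⊗id-via-ket0-mid) ⟩
  (Δ₁ ⊗ id 1) ⨾ C23₃              ∎

id⊗Δ₁-via-ket0 : id 1 ⊗ Δ₁ ≈ (id 2 ⊗ ket0) ⨾ C23₃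
id⊗Δ₁-via-ket0 = ≈-trans (⊗-cong ≈-refl Δ₁-via-cnot) (≈-trans id⊗-⨾ (≈-left (≈-sym id₂⊗ket0)))

cnot-id⊗Δ₁ : cnot ⨾ (id 1 ⊗ Δ₁) ≈ (id 1 ⊗ Δ₁) ⨾ C12₃ ⨾ C13₃
cnot-id⊗Δ₁ = begin
  cnot ⨾ (id 1 ⊗ Δ₁)                   ≈⟨ ≈-right id⊗Δ₁-via-ket0 ⟩
  cnot ⨾ ((id 2 ⊗ ket0) ⨾ C23₃)        ≈⟨ ≈-sym ⨾-assoc ⟩
  cnot ⨾ (id 2 ⊗ ket0) ⨾ C23₃          ≈⟨ ≈-left cnot-id⊗ket0 ⟩
  (id 2 ⊗ ket0) ⨾ C12₃ ⨾ C23₃          ≈⟨ ⨾-assoc ⟩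
  (id 2 ⊗ ket0) ⨾ (C12₃ ⨾ C23₃)        ≈⟨ ≈-right r8′ ⟩
  (id 2 ⊗ ket0) ⨾ (C23₃ ⨾ C13₃ ⨾ C12₃) ≈⟨ ≈-rebracket refl ⟩
  (id 2 ⊗ ket0) ⨾ C23₃ ⨾ C13₃ ⨾ C12₃   ≈⟨ ≈-left (≈-left (≈-sym id⊗Δ₁-via-ket0)) ⟩
  (id 1 ⊗ Δ₁) ⨾ C13₃ ⨾ C12₃            ≈⟨ ⨾-assoc ⟩
  (id 1 ⊗ Δ₁) ⨾ (C13₃ ⨾ C12₃)          ≈⟨ ≈-right (≈-sym C12₃-C13₃-comm) ⟩
  (id 1 ⊗ Δ₁) ⨾ (C12₃ ⨾ C13₃)          ≈⟨ ≈-sym ⨾-assoc ⟩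
  (id 1 ⊗ Δ₁) ⨾ C12₃ ⨾ C13₃            ∎

Δ₁⊗id-C12₃ : (Δ₁ ⊗ id 1) ⨾ C12₃ ≈ ket0-mid
Δ₁⊗id-C12₃ = ≈-trans (≈-sym ⨾-⊗id) (≈-trans (⊗-cong Δ₁-cnot ≈-refl) ⊗-assoc)

Δ₁⊗id-C23₃≈C13₃ : (Δ₁ ⊗ id 1) ⨾ C23₃ ≈ (Δ₁ ⊗ id 1) ⨾ C13₃
Δ₁⊗id-C23₃≈C13₃ = begin
  (Δ₁ ⊗ id 1) ⨾ C23₃                        ≈⟨ ≈-sym idʳ ⟩
  (Δ₁ ⊗ id 1) ⨾ C23₃ ⨾ id 3                 ≈⟨ ≈-right (≈-sym C13₃-involutive) ⟩
  (Δ₁ ⊗ id 1) ⨾ C23₃ ⨾ (C13₃ ⨾ C13₃)        ≈⟨ ≈-rebracket refl ⟩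
  (Δ₁ ⊗ id 1) ⨾ (C23₃ ⨾ C13₃) ⨾ C13₃        ≈⟨ ≈-middle (≈-sym r8) ⟩
  (Δ₁ ⊗ id 1) ⨾ (C12₃ ⨾ C23₃ ⨾ C12₃) ⨾ C13₃ ≈⟨ ≈-rebracket refl ⟩
  (Δ₁ ⊗ id 1) ⨾ C12₃ ⨾ C23₃ ⨾ C12₃ ⨾ C13₃   ≈⟨ ≈-left (≈-left (≈-left Δ₁⊗id-C12₃)) ⟩
  ket0-mid ⨾ C23₃ ⨾ C12₃ ⨾ C13₃             ≈⟨ ≈-left (≈-left ket0-mid-C23) ⟩
  ket0-mid ⨾ C12₃ ⨾ C13₃                    ≈⟨ ≈-left (≈-left (≈-sym Δ₁⊗id-C12₃)) ⟩
  (Δ₁ ⊗ id 1) ⨾ C12₃ ⨾ C12₃ ⨾ C13₃          ≈⟨ ≈-rebracket refl ⟩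
  (Δ₁ ⊗ id 1) ⨾ (C12₃ ⨾ C12₃) ⨾ C13₃        ≈⟨ ≈-middle C12₃-involutive ⟩
  (Δ₁ ⊗ id 1) ⨾ id 3 ⨾ C13₃                 ≈⟨ ≈-left idʳ ⟩
  (Δ₁ ⊗ id 1) ⨾ C13₃                        ∎

mid-swap : Tm 4 4
mid-swap = id 1 ⊗ (σ 1 1 ⊗ id 1)

mid-swap-involutive : mid-swap ⨾ mid-swap ≈ id 4
mid-swap-involutive = id⊗-involutive σ₁₁⊗id-involutive

id₂⊗Δ₁ : id 2 ⊗ Δ₁ ≈ id 1 ⊗ (id 1 ⊗ Δ₁)
id₂⊗Δ₁ = ≈-trans (⊗-cong (≈-sym ⊗-id) ≈-refl) ⊗-assoc

Δ₁⊗id₂ : Δ₁ ⊗ id 2 ≈ (Δ₁ ⊗ id 1) ⊗ id 1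
Δ₁⊗id₂ = ≈-trans (⊗-cong ≈-refl (≈-sym ⊗-id)) (≈-sym ⊗-assoc)

Δ₁⊗id₂-C23₃≈C13₃ : (Δ₁ ⊗ id 2) ⨾ (C23₃ ⊗ id 1) ≈ (Δ₁ ⊗ id 2) ⨾ (C13₃ ⊗ id 1)
Δ₁⊗id₂-C23₃≈C13₃ = begin
  (Δ₁ ⊗ id 2) ⨾ (C23₃ ⊗ id 1)          ≈⟨ ≈-left Δ₁⊗id₂ ⟩
  ((Δ₁ ⊗ id 1) ⊗ id 1) ⨾ (C23₃ ⊗ id 1) ≈⟨ ≈-sym ⨾-⊗id ⟩
  ((Δ₁ ⊗ id 1) ⨾ C23₃) ⊗ id 1          ≈⟨ ⊗-cong Δ₁⊗id-C23₃≈C13₃ ≈-refl ⟩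
  ((Δ₁ ⊗ id 1) ⨾ C13₃) ⊗ id 1          ≈⟨ ⨾-⊗id ⟩
  ((Δ₁ ⊗ id 1) ⊗ id 1) ⨾ (C13₃ ⊗ id 1) ≈⟨ ≈-left (≈-sym Δ₁⊗id₂) ⟩
  (Δ₁ ⊗ id 2) ⨾ (C13₃ ⊗ id 1)          ∎

C23₃-id₂⊗Δ₁ : C23₃ ⨾ (id 2 ⊗ Δ₁) ≈ (id 2 ⊗ Δ₁) ⨾ (id 1 ⊗ C12₃) ⨾ (id 1 ⊗ C13₃)
C23₃-id₂⊗Δ₁ = begin
  C23₃ ⨾ (id 2 ⊗ Δ₁)                                   ≈⟨ ≈-right id₂⊗Δ₁ ⟩
  C23₃ ⨾ (id 1 ⊗ (id 1 ⊗ Δ₁))                          ≈⟨ ≈-sym id⊗-⨾ ⟩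
  id 1 ⊗ (cnot ⨾ (id 1 ⊗ Δ₁))                          ≈⟨ ⊗-cong ≈-refl cnot-id⊗Δ₁ ⟩
  id 1 ⊗ ((id 1 ⊗ Δ₁) ⨾ C12₃ ⨾ C13₃)                   ≈⟨ ≈-trans id⊗-⨾ (≈-left id⊗-⨾) ⟩
  (id 1 ⊗ (id 1 ⊗ Δ₁)) ⨾ (id 1 ⊗ C12₃) ⨾ (id 1 ⊗ C13₃) ≈⟨ ≈-left (≈-left (≈-sym id₂⊗Δ₁)) ⟩
  (id 2 ⊗ Δ₁) ⨾ (id 1 ⊗ C12₃) ⨾ (id 1 ⊗ C13₃)          ∎

cnot-Δ₁⊗Δ₁ : cnot ⨾ (Δ₁ ⊗ Δ₁) ≈ (Δ₁ ⊗ Δ₁) ⨾ (C13₃ ⊗ id 1) ⨾ (id 1 ⊗ C13₃)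
cnot-Δ₁⊗Δ₁ = begin
  cnot ⨾ (Δ₁ ⊗ Δ₁)                                            ≈⟨ ≈-right (≈-sym ⊗-merge) ⟩
  cnot ⨾ ((Δ₁ ⊗ id 1) ⨾ (id 2 ⊗ Δ₁))                          ≈⟨ ≈-sym ⨾-assoc ⟩
  cnot ⨾ (Δ₁ ⊗ id 1) ⨾ (id 2 ⊗ Δ₁)                            ≈⟨ ≈-left cnot-Δ₁⊗id ⟩
  (Δ₁ ⊗ id 1) ⨾ C23₃ ⨾ (id 2 ⊗ Δ₁)                            ≈⟨ ⨾-assoc ⟩
  (Δ₁ ⊗ id 1) ⨾ (C23₃ ⨾ (id 2 ⊗ Δ₁))                          ≈⟨ ≈-right C23₃-id₂⊗Δ₁ ⟩
  (Δ₁ ⊗ id 1) ⨾ ((id 2 ⊗ Δ₁) ⨾ (id 1 ⊗ C12₃) ⨾ (id 1 ⊗ C13₃)) ≈⟨ ≈-rebracket refl ⟩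
  ((Δ₁ ⊗ id 1) ⨾ (id 2 ⊗ Δ₁)) ⨾ (id 1 ⊗ C12₃) ⨾ (id 1 ⊗ C13₃) ≈⟨ ≈-left (≈-left ⊗-slide) ⟩
  ((id 1 ⊗ Δ₁) ⨾ (Δ₁ ⊗ id 2)) ⨾ (id 1 ⊗ C12₃) ⨾ (id 1 ⊗ C13₃) ≈⟨ ≈-left (≈-right (≈-sym ⊗-assoc)) ⟩
  ((id 1 ⊗ Δ₁) ⨾ (Δ₁ ⊗ id 2)) ⨾ (C23₃ ⊗ id 1) ⨾ (id 1 ⊗ C13₃) ≈⟨ ≈-left ⨾-assoc ⟩
  (id 1 ⊗ Δ₁) ⨾ ((Δ₁ ⊗ id 2) ⨾ (C23₃ ⊗ id 1)) ⨾ (id 1 ⊗ C13₃) ≈⟨ ≈-left (≈-right Δ₁⊗id₂-C23₃≈C13₃) ⟩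
  (id 1 ⊗ Δ₁) ⨾ ((Δ₁ ⊗ id 2) ⨾ (C13₃ ⊗ id 1)) ⨾ (id 1 ⊗ C13₃) ≈⟨ ≈-left (≈-sym ⨾-assoc) ⟩
  ((id 1 ⊗ Δ₁) ⨾ (Δ₁ ⊗ id 2)) ⨾ (C13₃ ⊗ id 1) ⨾ (id 1 ⊗ C13₃) ≈⟨ ≈-left (≈-left ⊗-merge′) ⟩
  (Δ₁ ⊗ Δ₁) ⨾ (C13₃ ⊗ id 1) ⨾ (id 1 ⊗ C13₃)                   ∎

id⊗C13₃-conjugate : id 1 ⊗ C13₃ ≈ mid-swap ⨾ (id 2 ⊗ cnot) ⨾ mid-swap
id⊗C13₃-conjugate = begin
  id 1 ⊗ C13₃                         ≈⟨ ⊗-cong ≈-refl (≈-sym C13₃-conjugate) ⟩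
  id 1 ⊗ (σ₁₁⊗id ⨾ C23₃ ⨾ σ₁₁⊗id)     ≈⟨ ≈-trans id⊗-⨾ (≈-left id⊗-⨾) ⟩
  mid-swap ⨾ (id 1 ⊗ C23₃) ⨾ mid-swap ≈⟨ ≈-middle id⊗-id⊗ ⟩
  mid-swap ⨾ (id 2 ⊗ cnot) ⨾ mid-swap ∎

C13₃⊗id-conjugate : C13₃ ⊗ id 1 ≈ mid-swap ⨾ (cnot ⊗ id 2) ⨾ mid-swap
C13₃⊗id-conjugate = begin
  C13₃ ⊗ id 1                                                ≈⟨ ≈-trans ⨾-⊗id (≈-left ⨾-⊗id) ⟩
  (id⊗σ₁₁ ⊗ id 1) ⨾ ((cnot ⊗ id 1) ⊗ id 1) ⨾ (id⊗σ₁₁ ⊗ id 1) ≈⟨ ⨾-cong (⨾-cong ⊗-assoc ⊗id-⊗id) ⊗-assoc ⟩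
  mid-swap ⨾ (cnot ⊗ id 2) ⨾ mid-swap                        ∎

C13₃-pair-mid-swap : (C13₃ ⊗ id 1) ⨾ (id 1 ⊗ C13₃) ⨾ mid-swap ≈ mid-swap ⨾ (cnot ⊗ cnot)
C13₃-pair-mid-swap = begin
  (C13₃ ⊗ id 1) ⨾ (id 1 ⊗ C13₃) ⨾ mid-swap
    ≈⟨ ≈-left (⨾-cong C13₃⊗id-conjugate id⊗C13₃-conjugate) ⟩
  (mid-swap ⨾ (cnot ⊗ id 2) ⨾ mid-swap) ⨾ (mid-swap ⨾ (id 2 ⊗ cnot) ⨾ mid-swap) ⨾ mid-swap
    ≈⟨ ≈-rebracket refl ⟩
  mid-swap ⨾ (cnot ⊗ id 2) ⨾ (mid-swap ⨾ mid-swap) ⨾ (id 2 ⊗ cnot) ⨾ (mid-swap ⨾ mid-swap)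
    ≈⟨ ⨾-cong (≈-left (≈-right mid-swap-involutive)) mid-swap-involutive ⟩
  mid-swap ⨾ (cnot ⊗ id 2) ⨾ id 4 ⨾ (id 2 ⊗ cnot) ⨾ id 4
    ≈⟨ ≈-trans idʳ (≈-left idʳ) ⟩
  mid-swap ⨾ (cnot ⊗ id 2) ⨾ (id 2 ⊗ cnot)
    ≈⟨ ≈-trans ⨾-assoc (≈-right ⊗-merge) ⟩
  mid-swap ⨾ (cnot ⊗ cnot) ∎

-- Δ 2 is (Δ₁ ⊗ Δ₁) ⨾ mid-swap; pushing cnot through Δ₁ ⊗ Δ₁ yields a C₁₃ on each
-- copy, and mid-swap conjugates these two gates into cnot ⊗ cnot.
cnot-ΔNatural : cnot ⨾ Δ 2 ≈ Δ 2 ⨾ (cnot ⊗ cnot)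
cnot-ΔNatural = begin
  cnot ⨾ ((Δ₁ ⊗ Δ₁) ⨾ mid-swap)                          ≈⟨ ≈-sym ⨾-assoc ⟩
  (cnot ⨾ (Δ₁ ⊗ Δ₁)) ⨾ mid-swap                          ≈⟨ ≈-left cnot-Δ₁⊗Δ₁ ⟩
  (Δ₁ ⊗ Δ₁) ⨾ (C13₃ ⊗ id 1) ⨾ (id 1 ⊗ C13₃) ⨾ mid-swap   ≈⟨ ≈-rebracket refl ⟩
  (Δ₁ ⊗ Δ₁) ⨾ ((C13₃ ⊗ id 1) ⨾ (id 1 ⊗ C13₃) ⨾ mid-swap) ≈⟨ ≈-right C13₃-pair-mid-swap ⟩
  (Δ₁ ⊗ Δ₁) ⨾ (mid-swap ⨾ (cnot ⊗ cnot))                 ≈⟨ ≈-sym ⨾-assoc ⟩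
  (Δ₁ ⊗ Δ₁) ⨾ mid-swap ⨾ (cnot ⊗ cnot)                   ∎

σ₁₁⊗id₂ : Tm 4 4
σ₁₁⊗id₂ = σ 1 1 ⊗ id 2
id₂⊗σ₁₁ : Tm 4 4
id₂⊗σ₁₁ = id 2 ⊗ σ 1 1

σ₂₂-split : σ 2 2 ≈ mid-swap ⨾ σ₁₁⊗id₂ ⨾ (id₂⊗σ₁₁ ⨾ mid-swap)
σ₂₂-split = begin
  σ 2 2
    ≈⟨ ≅⇒≈ σ-hexagon ⟩
  (σ 2 1 ⊗ id 1) ⨾ (id 1 ⊗ σ 2 1)
    ≈⟨ ⨾-cong (⊗-cong σ₂₁-split ≈-refl) (⊗-cong ≈-refl σ₂₁-split) ⟩
  ((id⊗σ₁₁ ⨾ σ₁₁⊗id) ⊗ id 1) ⨾ (id 1 ⊗ (id⊗σ₁₁ ⨾ σ₁₁⊗id))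
    ≈⟨ ⨾-cong ⨾-⊗id id⊗-⨾ ⟩
  ((id⊗σ₁₁ ⊗ id 1) ⨾ (σ₁₁⊗id ⊗ id 1)) ⨾ ((id 1 ⊗ id⊗σ₁₁) ⨾ (id 1 ⊗ σ₁₁⊗id))
    ≈⟨ ⨾-cong (⨾-cong ⊗-assoc ⊗id-⊗id) (≈-left id⊗-id⊗) ⟩
  mid-swap ⨾ σ₁₁⊗id₂ ⨾ (id₂⊗σ₁₁ ⨾ mid-swap) ∎

σ₁₁-ΔNatural : σ 1 1 ⨾ Δ 2 ≈ Δ 2 ⨾ (σ 1 1 ⊗ σ 1 1)
σ₁₁-ΔNatural = begin
  σ 1 1 ⨾ ((Δ₁ ⊗ Δ₁) ⨾ mid-swap)                                       ≈⟨ ≈-sym ⨾-assoc ⟩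
  (σ 1 1 ⨾ (Δ₁ ⊗ Δ₁)) ⨾ mid-swap                                       ≈⟨ ≈-left (≈-sym σ-nat) ⟩
  ((Δ₁ ⊗ Δ₁) ⨾ σ 2 2) ⨾ mid-swap                                       ≈⟨ ≈-left (≈-right σ₂₂-split) ⟩
  ((Δ₁ ⊗ Δ₁) ⨾ (mid-swap ⨾ σ₁₁⊗id₂ ⨾ (id₂⊗σ₁₁ ⨾ mid-swap))) ⨾ mid-swap ≈⟨ ≈-rebracket refl ⟩
  (Δ₁ ⊗ Δ₁) ⨾ mid-swap ⨾ σ₁₁⊗id₂ ⨾ id₂⊗σ₁₁ ⨾ (mid-swap ⨾ mid-swap)     ≈⟨ ≈-right mid-swap-involutive ⟩
  (Δ₁ ⊗ Δ₁) ⨾ mid-swap ⨾ σ₁₁⊗id₂ ⨾ id₂⊗σ₁₁ ⨾ id 4                      ≈⟨ idʳ ⟩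
  (Δ₁ ⊗ Δ₁) ⨾ mid-swap ⨾ σ₁₁⊗id₂ ⨾ id₂⊗σ₁₁                             ≈⟨ ≈-trans ⨾-assoc (≈-right ⊗-merge) ⟩
  (Δ₁ ⊗ Δ₁) ⨾ mid-swap ⨾ (σ 1 1 ⊗ σ 1 1)                               ∎

Copyable-cnot : Copyable cnot
Copyable-cnot = cnot-ΔNatural , ΔNatural∧unitary⇒ΔTranspose cnot-ΔNatural r2

Copyable-σ₁₁ : Copyable (σ 1 1)
Copyable-σ₁₁ = σ₁₁-ΔNatural , ΔNatural∧unitary⇒ΔTranspose σ₁₁-ΔNatural σ-inv

Copyable-ket1 : Copyable ket1
Copyable-ket1 = ket1-ΔNatural , ket1-ΔTranspose

Copyable-bra1 : Copyable bra1
Copyable-bra1 = bra1-ΔNatural , bra1-ΔTranspose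

Copyable-σ₁ : ∀ a → Copyable (σ a 1)
Copyable-σ₁ zero    = Copyable-resp-≅ (≅-sym σ-unitˡ≅) Copyable-id
Copyable-σ₁ (suc a) = Copyable-resp-≅ (≅-sym (σ-hexagon′ {1} {1} {a}))
  (Copyable-⨾[] _ (Copyable-⊗ Copyable-id (Copyable-σ₁ a)) (Copyable-⊗ Copyable-σ₁₁ Copyable-id))

Copyable-σ : ∀ a b → Copyable (σ a b)
Copyable-σ a zero    = Copyable-resp-≅ (≅-sym σ-unitʳ≅) Copyable-id
Copyable-σ a (suc c) = Copyable-resp-≅ (≅-sym (σ-hexagon {a} {1} {c}))
  (Copyable-⨾[] _ (Copyable-⊗ (Copyable-σ₁ a) Copyable-id) (Copyable-⊗ Copyable-id (Copyable-σ a c)))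

copyable : ∀ {a b} (f : Tm a b) → Copyable f
copyable (id a)  = Copyable-id
copyable (f ⨾ g) = Copyable-⨾ (copyable f) (copyable g)
copyable (f ⊗ g) = Copyable-⊗ (copyable f) (copyable g)
copyable (σ a b) = Copyable-σ a b
copyable cnot    = Copyable-cnot
copyable ket1    = Copyable-ket1
copyable bra1    = Copyable-bra1

Δ⨾∇ : ∀ n → Δ n ⨾ ∇ n ≈ id n
Δ⨾∇ zero    = idˡ
Δ⨾∇ (suc k) = ≅⇒≈
  (≅-trans (⨾≅ (Δ-suc k) (flip-cong≅ (Δ-suc k)))
  (≅-trans (≈⇒≅ (≈-trans ⨾-assoc (≈-right (≈-sym ⨾-assoc))))
  (≅-trans (⨾≅ ≅-refl (idˡ-upto interleave-cast-unitary))
  (≅-trans (≈⇒≅ (≈-trans (≈-sym interchange) (≈-trans (⊗-cong (Δ⨾∇ k) Δ₁⨾∇₁) ⊗-id)))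
  (id≅ (trans (+-suc k 0) (cong suc (+-identityʳ k))))))))
  where
  dom = interleave-dom k k 1 1
  interleave-cast-unitary : cast (sym dom) refl (interleave k k 1 1) ⨾ flip (cast (sym dom) refl (interleave k k 1 1))
                            ≅ id (k + ((k + 1) + 1))
  interleave-cast-unitary =
    ≅-trans (⨾≅ (cast≅ _ _ _) (≅-trans (≡⇒≅ (flip-cast (sym dom) refl (interleave k k 1 1))) (cast≅ _ _ _)))
            (≈⇒≅ (interleave-unitary k k 1 1))

latchable-⨾flip : ∀ {n m} (f : Tm n m) → Copyable f → Latchable (f ⨾ flip f)
latchable-⨾flip {n} {m} f (nf , pf) = ≈-sym (begin
  Δ n ⨾ ((f ⨾ flip f) ⊗ id n) ⨾ ∇ n                   ≈⟨ ≈-left (≈-right ⨾-⊗id) ⟩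
  Δ n ⨾ ((f ⊗ id n) ⨾ (flip f ⊗ id n)) ⨾ ∇ n          ≈⟨ ≈-left (≈-sym ⨾-assoc) ⟩
  Δ n ⨾ (f ⊗ id n) ⨾ (flip f ⊗ id n) ⨾ ∇ n            ≈⟨ ≈-left (≈-left pf) ⟩
  f ⨾ Δ m ⨾ (id m ⊗ flip f) ⨾ (flip f ⊗ id n) ⨾ ∇ n   ≈⟨ ≈-left ⨾-assoc ⟩
  f ⨾ Δ m ⨾ ((id m ⊗ flip f) ⨾ (flip f ⊗ id n)) ⨾ ∇ n ≈⟨ ≈-left (≈-right ⊗-merge′) ⟩
  f ⨾ Δ m ⨾ (flip f ⊗ flip f) ⨾ ∇ n                   ≈⟨ ⨾-assoc ⟩
  f ⨾ Δ m ⨾ ((flip f ⊗ flip f) ⨾ ∇ n)                 ≈⟨ ≈-right (≈-sym (flip-cong nf)) ⟩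
  f ⨾ Δ m ⨾ (∇ m ⨾ flip f)                            ≈⟨ ≈-trans (≈-sym ⨾-assoc) (≈-left ⨾-assoc) ⟩
  f ⨾ (Δ m ⨾ ∇ m) ⨾ flip f                            ≈⟨ ≈-middle (Δ⨾∇ m) ⟩
  f ⨾ id m ⨾ flip f                                   ≈⟨ ≈-left idʳ ⟩
  f ⨾ flip f                                          ∎)

mainTheorem18 : {n m : ℕ} (f : Tm n m) → Latchable (f ⨾ flip f)
mainTheorem18 f = latchable-⨾flip f (copyable f)
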